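{- Let $\Sigma=(\Gamma,\sigma)$ be a signed graph and let $\lambda,\mu$ be integers with $\lambda\ge\mu\ge0$. Then \[ f(\Sigma,\lambda,\mu)=\sum_{i=0}^{|E(\Gamma)|}(-1)^i\sum_{\substack{Y\subseteq E(\Gamma)\\ |Y|=i}}\lambda^{p(\Sigma|Y)}\,(\lambda-\mu)^{b(\Sigma|Y)-p(\Sigma|Y)}\,\delta^{c(\Sigma|Y)-b(\Sigma|Y)}, \] where $\delta\in\{0,1\}$ is congruent to $\lambda-\mu$ modulo $2$, and $0^0=1$.
   Context: A signed graph $\Sigma=(\Gamma,\sigma)$ is a finite simple graph $\Gamma$ with a signature $\sigma:E(\Gamma)\to\{\pm1\}$. A cycle is negative if it has an odd number of negative edges; a signed graph is balanced if it has no negative cycle. For $Y\subseteq E(\Gamma)$, $\Sigma|Y$ is the spanning signed subgraph $((V(\Gamma),Y),\sigma|_Y)$. For a signed graph $\Lambda$, $c(\Lambda)$ is the number of connected components, $b(\Lambda)$ the number of balanced connected components, and $p(\Lambda)$ the number of connected components all of whose edges are positive (isolated vertices count as all-positive components). Let $\lambda\ge\mu\ge0$ be integers. A finite set $C\subseteq\mathbb Z$ is a $(\lambda,\mu)$-colour set if there are disjoint sets $P,U$ of nonzero integers with $-P=P$, $|U|=\mu$, $(-U)\cap U=\varnothing$, and either $\lambda-\mu$ is even, $|P|=\lambda-\mu$ and $C=P\cup U$, or $\lambda-\mu$ is odd, $|P|=\lambda-\mu-1$ and $C=P\cup U\cup\{0\}$. A proper $C$-colouring of $\Sigma$ is a map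 $\kappa:V(\Gamma)\to C$ with $\kappa(v)\ne\sigma(\{v,w\})\kappa(w)$ for every edge $\{v,w\}$. $f(\Sigma,\lambda,\mu)$ denotes the number of proper $C$-colourings of $\Sigma$ for a $(\lambda,\mu)$-colour set $C$ (this number does not depend on the choice of $C$). -}

module Defs where

open import Data.Bool using (Bool; true; false)
open import Data.Nat as ℕ using (ℕ; zero; suc; _∸_; _%_)
open import Data.Integer as ℤ using (ℤ; +_; -_)
open import Data.Fin as Fin using (Fin; inject₁; fromℕ)
open import Data.Fin.Properties using (all?)
open import Data.Fin.Subset using (Subset; ∣_∣; inside; outside) renaming (_∈_ to _∈ₛ_)
open import Data.Vec using (Vec; []; _∷_; lookup)
open import Data.List using (List; []; _∷_; [_]; length; filter; filterᵇ; map; concatMap; foldr; upTo; allFin)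
open import Data.List.Relation.Unary.Unique.Propositional using (Unique)
open import Data.List.Membership.Propositional using (_∈_)
open import Data.Product using (Σ; ∃; ∃₂; _×_; _,_; proj₁; proj₂)
open import Data.Sum using (_⊎_)
open import Data.Empty using (⊥)
open import Relation.Binary.PropositionalEquality using (_≡_; _≢_)
open import Relation.Nullary using (¬_; Dec; ¬?)
open import Relation.Unary using (Decidable)
open import Relation.Binary.Construct.Closure.ReflexiveTransitive using (Star)

data Sign : Set where
  pos neg : Sign

isNeg : Sign → Bool
isNeg pos = false
isNeg neg = true

applySign : Sign → ℤ → ℤ
applySign pos x = x
applySign neg x = - x

record SignedGraph : Set where
  field
    n    : ℕ
    m    : ℕ
    ends : Fin m → Fin n × Fin n
    σ    : Fin m → Sign

  Joins : Fin m → Fin n → Fin n → Set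
  Joins e a b = ends e ≡ (a , b) ⊎ ends e ≡ (b , a)

  field
    loopless : ∀ e → proj₁ (ends e) ≢ proj₂ (ends e)
    simple   : ∀ e e' → Joins e' (proj₁ (ends e)) (proj₂ (ends e)) → e ≡ e'

open SignedGraph public

-- Counting the elements of Fin n satisfying a (not necessarily decidable)
-- predicate: HasCount Q k means |{v | Q v}| = k.

HasCount : (n : ℕ) → (Fin n → Set) → ℕ → Set
HasCount n Q k = Σ (List (Fin n)) λ L →
  Unique L × length L ≡ k × (∀ v → (v ∈ L → Q v) × (Q v → v ∈ L))

module _ (G : SignedGraph) (Y : Subset (m G)) where

  Adj : Fin (n G) → Fin (n G) → Set
  Adj v w = ∃ λ e → e ∈ₛ Y × Joins G e v w

  Conn : Fin (n G) → Fin (n G) → Set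
  Conn = Star Adj

  -- v is the least vertex of its component (one representative per component)
  Rep : Fin (n G) → Set
  Rep v = ∀ w → Conn v w → v Fin.≤ w

  record NegCycle (v : Fin (n G)) : Set where
    field
      k        : ℕ
      long     : 3 ℕ.≤ k
      ws       : Fin (suc k) → Fin (n G)
      closed   : ws (fromℕ k) ≡ ws Fin.zero
      distinct : ∀ i j → ws (inject₁ i) ≡ ws (inject₁ j) → i ≡ j
      es       : Fin k → Fin (m G)
      esInY    : ∀ i → es i ∈ₛ Y
      esJoin   : ∀ i → Joins G (es i) (ws (inject₁ i)) (ws (Fin.suc i))
      inComp   : Conn v (ws Fin.zero)
      negative : length (filterᵇ (λ i → isNeg (σ G (es i))) (allFin k)) % 2 ≡ 1

  BalancedComp : Fin (n G) → Set
  BalancedComp v = ¬ NegCycle v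

  AllPosComp : Fin (n G) → Set
  AllPosComp v = ∀ e → e ∈ₛ Y → Conn v (proj₁ (ends G e)) → σ G e ≡ pos

  IsC : ℕ → Set
  IsC = HasCount (n G) Rep
  IsB : ℕ → Set
  IsB = HasCount (n G) (λ v → Rep v × BalancedComp v)
  IsP : ℕ → Set
  IsP = HasCount (n G) (λ v → Rep v × AllPosComp v)

Even Odd : ℕ → Set
Even x = x % 2 ≡ 0
Odd x = x % 2 ≡ 1

IsColourSet : ℕ → ℕ → List ℤ → Set
IsColourSet lam mu C = Unique C × ∃₂ λ (P U : List ℤ) →
  Unique P × Unique U
  × (∀ x → x ∈ P → x ∈ U → ⊥)
  × (∀ x → x ∈ P → x ≢ + 0)
  × (∀ x → x ∈ U → x ≢ + 0)
  × (∀ x → x ∈ P → - x ∈ P)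
  × (∀ x → x ∈ U → - x ∈ U → ⊥)
  × length U ≡ mu
  × ( (Even (lam ∸ mu) × length P ≡ lam ∸ mu
         × (∀ x → (x ∈ C → x ∈ P ⊎ x ∈ U) × (x ∈ P ⊎ x ∈ U → x ∈ C)))
    ⊎ (Odd (lam ∸ mu) × length P ≡ lam ∸ mu ∸ 1
         × (∀ x → (x ∈ C → x ∈ P ⊎ x ∈ U ⊎ x ≡ + 0)
                × (x ∈ P ⊎ x ∈ U ⊎ x ≡ + 0 → x ∈ C))) )

allMaps : {A : Set} → (k : ℕ) → List A → List (Vec A k)
allMaps zero    xs = [ [] ]
allMaps (suc k) xs = concatMap (λ x → map (x ∷_) (allMaps k xs)) xs

Proper : (G : SignedGraph) → Vec ℤ (n G) → Set
Proper G κ = ∀ e → lookup κ (proj₁ (ends G e)) ≢ applySign (σ G e) (lookup κ (proj₂ (ends G e)))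

proper? : (G : SignedGraph) → Decidable (Proper G)
proper? G κ = all? (λ e → ¬? (lookup κ (proj₁ (ends G e)) ℤ.≟ applySign (σ G e) (lookup κ (proj₂ (ends G e)))))

numProper : SignedGraph → List ℤ → ℕ
numProper G C = length (filter (proper? G) (allMaps (n G) C))

sumℤ : List ℤ → ℤ
sumℤ = foldr ℤ._+_ (+ 0)

subsetsOfSize : (m : ℕ) → ℕ → List (Subset m)
subsetsOfSize m i = filter (λ Y → ∣ Y ∣ ℕ.≟ i) (allMaps m (inside ∷ outside ∷ []))

δ : ℕ → ℕ → ℕ
δ lam mu = (lam ∸ mu) % 2

rhs : (G : SignedGraph) (lam mu : ℕ) (c b p : Subset (m G) → ℕ) → ℤ
rhs G lam mu c b p =
  sumℤ (map (λ i → ((- (+ 1)) ℤ.^ i) ℤ.* sumℤ (map term (subsetsOfSize (m G) i))) (upTo (suc (m G))))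
  where
  term : Subset (m G) → ℤ
  term Y = ((+ lam) ℤ.^ p Y) ℤ.* (((+ (lam ∸ mu)) ℤ.^ (b Y ∸ p Y)) ℤ.* ((+ δ lam mu) ℤ.^ (c Y ∸ b Y)))

-- Writing [κ proper] = ∏_e (1 − [e improper under κ]) and expanding the product
-- gives f(Σ,λ,μ) = Σ_Y (−1)^|Y| N(Y), where N(Y) counts the colourings κ with κ(v) = σ(e)κ(w)
-- on every edge e = vw of Y.  Such a κ is determined by its values at the least vertex of each
-- component of Σ|Y: along a walk from the representative r the colour is multiplied by the sign
-- of the walk.  On an all-positive component κ(r) is arbitrary (λ choices); on a balanced one with
-- a negative edge both κ(r) and −κ(r) must be colours (λ − μ choices); on an unbalanced one a
-- negative closed walk, which shortens to a negative cycle, forces κ(r) = −κ(r) = 0 (δ choices).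
-- So N(Y) = λ^p (λ−μ)^(b−p) δ^(c−b).
module Submission where

open import Defs
open import Level using (0ℓ)
open import Function using (_∘_; _⇔_; mk⇔; Equivalence)
open import Data.Bool using (Bool; true; false; if_then_else_)
open import Data.Empty using (⊥)
open import Data.Unit using (⊤; tt)
open import Data.Product using (Σ; ∃; _×_; _,_; proj₁; proj₂)
open import Data.Sum using (_⊎_; inj₁; inj₂; [_,_]′)
open import Data.Nat as ℕ using (ℕ; zero; suc; s≤s; z≤n)
import Data.Nat.Properties as ℕₚ
open import Data.Integer as ℤ using (ℤ)
import Data.Integer.Properties as ℤₚ
open import Data.Fin as Fin using (Fin)
open import Data.Fin.Properties using (all?)
open import Data.Fin.Subset using (Subset; inside; outside; ∣_∣) renaming (_∈_ to _∈ₛ_)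
open import Data.Fin.Subset.Properties using () renaming (_∈?_ to _∈ₛ?_)
open import Data.Vec as Vec using (Vec; []; _∷_; lookup)
open import Data.Vec.Properties using (∷-injective)
open import Data.List
  using (List; []; _∷_; [_]; length; filter; filterᵇ; map; _++_; concatMap; allFin; tabulate; upTo; cartesianProductWith)
open import Data.List.Properties
  using (length-++; length-map; filter-++; filter-≐; filter-none; filter-all; filter-some; map-tabulate; map-cong; map-cong-local; map-∘)
open import Data.List.Membership.Propositional using (_∈_)
open import Data.List.Membership.Propositional.Properties
  using (∈-filter⁺; ∈-filter⁻; ∈-allFin; ∈-upTo⁺; ∈-map⁺; ∈-map⁻; ∈-cartesianProductWith⁺; ∈-cartesianProductWith⁻)
open import Data.List.Membership.Propositional.Properties.WithK using (unique∧set⇒bag)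
open import Data.List.Relation.Unary.Any as Any using (here; there)
open import Data.List.Relation.Unary.All using (All)
import Data.List.Relation.Unary.All as All
import Data.List.Relation.Unary.All.Properties as All
open import Data.List.Relation.Unary.AllPairs using ([]; _∷_)
open import Data.List.Relation.Unary.Unique.Propositional using (Unique)
import Data.List.Relation.Unary.Unique.Propositional.Properties as Unique
open import Data.List.Relation.Binary.BagAndSetEquality using (∼bag⇒↭)
open import Data.List.Relation.Binary.Permutation.Propositional.Properties using (↭-length)
open import Relation.Binary using (DecidableEquality)
open import Relation.Binary.PropositionalEquality hiding ([_])
open import Relation.Nullary using (¬_; Dec; yes; no; does; ¬?; _×-dec_; _→-dec_; _⊎-dec_)
open import Relation.Nullary.Decidable using (T?; dec-true; dec-false; decidable-stable; ¬¬-excluded-middle)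
open import Relation.Nullary.Negation using (contradiction; ¬¬-Monad)
open import Relation.Unary using (Pred; Decidable)
open import Relation.Unary.Properties using (U?)
open import Effect.Monad using (RawMonad)
open import Algebra.Properties.CommutativeMonoid.Sum ℕₚ.*-1-commutativeMonoid
  using () renaming (sum to ∏; ∑-distrib-+ to ∏-distrib-*; sum-cong-≗ to ∏-cong)

𝟙 : {A : Set} → Dec A → ℕ
𝟙 a? = if does a? then 1 else 0

𝟙-yes : {A : Set} (a? : Dec A) → A → 𝟙 a? ≡ 1
𝟙-yes a? a = cong (λ b → if b then 1 else 0) (dec-true a? a)

𝟙-no : {A : Set} (a? : Dec A) → ¬ A → 𝟙 a? ≡ 0
𝟙-no a? ¬a = cong (λ b → if b then 1 else 0) (dec-false a? ¬a)

module Arithmetic where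

  open import Data.Nat using (_+_; _*_; _^_; _∸_; _≤_; _<_; _%_; parity)
  open import Data.Nat.Properties using (+-comm; ≤-pred; +-monoʳ-≤; module ≤-Reasoning)
  open import Data.Nat.Solver using (module +-*-Solver)
  open import Data.Parity.Base as ℙ using (0ℙ; 1ℙ)

  a+[b+c]≤1+f⇒b≤f : ∀ a b c {f} → a + (b + c) ≤ suc f → 0 < a + c → b ≤ f
  a+[b+c]≤1+f⇒b≤f a b c {f} bound a+c>0 = ≤-pred (begin
    suc b         ≡⟨ +-comm 1 b ⟩
    b + 1         ≤⟨ +-monoʳ-≤ b a+c>0 ⟩
    b + (a + c)   ≡⟨ solve 3 (λ a b c → b :+ (a :+ c) := a :+ (b :+ c)) refl a b c ⟩
    a + (b + c)   ≤⟨ bound ⟩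
    suc f         ∎)
    where
    open ≤-Reasoning
    open +-*-Solver

  a+[b+c]≤1+f⇒a+c≤f : ∀ a b c {f} → a + (b + c) ≤ suc f → 0 < b → a + c ≤ f
  a+[b+c]≤1+f⇒a+c≤f a b c {f} bound b>0 = ≤-pred (begin
    suc (a + c)   ≡⟨ +-comm 1 (a + c) ⟩
    a + c + 1     ≤⟨ +-monoʳ-≤ (a + c) b>0 ⟩
    a + c + b     ≡⟨ solve 3 (λ a b c → a :+ c :+ b := a :+ (b :+ c)) refl a b c ⟩
    a + (b + c)   ≤⟨ bound ⟩
    suc f         ∎)
    where
    open ≤-Reasoning
    open +-*-Solver

  0^a*[0^b*0^c]≡0 : ∀ a b c → 0 < a + (b + c) → 0 ^ a * (0 ^ b * 0 ^ c) ≡ 0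
  0^a*[0^b*0^c]≡0 (suc a) b       c       _ = refl
  0^a*[0^b*0^c]≡0 zero    (suc b) c       _ = refl
  0^a*[0^b*0^c]≡0 zero    zero    (suc c) _ = refl

  d∸1+1≡d : ∀ d → d % 2 ≡ 1 → d ∸ 1 + 1 ≡ d
  d∸1+1≡d (suc d) _ = +-comm d 1

  parity≡1ℙ⇒%2≡1 : ∀ k → parity k ≡ 1ℙ → k % 2 ≡ 1
  parity≡1ℙ⇒%2≡1 1             _  = refl
  parity≡1ℙ⇒%2≡1 (suc (suc k)) eq = parity≡1ℙ⇒%2≡1 k eq

  %2≡1⇒parity≡1ℙ : ∀ k → k % 2 ≡ 1 → parity k ≡ 1ℙ
  %2≡1⇒parity≡1ℙ 1             _  = refl
  %2≡1⇒parity≡1ℙ (suc (suc k)) eq = %2≡1⇒parity≡1ℙ k eq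

  p+q≡0ℙ⇒q≡p : ∀ p q → p ℙ.+ q ≡ 0ℙ → q ≡ p
  p+q≡0ℙ⇒q≡p 0ℙ 0ℙ _ = refl
  p+q≡0ℙ⇒q≡p 1ℙ 1ℙ _ = refl

least : ∀ {k} {P : Pred (Fin k) 0ℓ} → Decidable P → ∀ {v} → P v → Σ (Fin k) λ w → P w × (∀ {w′} → P w′ → w Fin.≤ w′)
least {suc k} P? pv with P? Fin.zero
... | yes p₀ = Fin.zero , p₀ , λ _ → z≤n
least {suc k} P? {Fin.zero}  pv | no ¬p₀ = contradiction pv ¬p₀
least {suc k} P? {Fin.suc v} pv | no ¬p₀ with least (P? ∘ Fin.suc) pv
... | w , pw , minimal = Fin.suc w , pw , λ { {Fin.zero} p → contradiction p ¬p₀ ; {Fin.suc w′} p → s≤s (minimal p) }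

module Counting where

  open import Data.Nat using (_+_; _*_; _^_; _<_)

  module _ {A : Set} where

    unique∧set⇒length-≡ : {xs ys : List A} → Unique xs → Unique ys →
      (∀ {x} → x ∈ xs → x ∈ ys) → (∀ {x} → x ∈ ys → x ∈ xs) → length xs ≡ length ys
    unique∧set⇒length-≡ xs-unique ys-unique to from =
      ↭-length (∼bag⇒↭ (unique∧set⇒bag xs-unique ys-unique (mk⇔ to from)))

    map⁺-injectiveOn : {B : Set} {f : A → B} {xs : List A} →
      (∀ {x y} → x ∈ xs → y ∈ xs → f x ≡ f y → x ≡ y) → Unique xs → Unique (map f xs)
    map⁺-injectiveOn {xs = []} inj [] = []
    map⁺-injectiveOn {xs = x ∷ xs} inj (x∉xs ∷ xs-unique) =
      All.map⁺ (All.tabulate λ y∈xs fx≡fy → All.lookup x∉xs y∈xs (inj (here refl) (there y∈xs) fx≡fy))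
      ∷ map⁺-injectiveOn (λ x∈xs y∈xs → inj (there x∈xs) (there y∈xs)) xs-unique

    length-filter-∷ : {P : Pred A 0ℓ} (P? : Decidable P) (x : A) (xs : List A) →
      length (filter P? (x ∷ xs)) ≡ 𝟙 (P? x) + length (filter P? xs)
    length-filter-∷ P? x xs with does (P? x)
    ... | true  = refl
    ... | false = refl

    length-filter-map : {B : Set} {P : Pred B 0ℓ} (P? : Decidable P) (f : A → B) (xs : List A) →
      length (filter P? (map f xs)) ≡ length (filter (P? ∘ f) xs)
    length-filter-map P? f [] = refl
    length-filter-map P? f (x ∷ xs) with does (P? (f x))
    ... | true  = cong suc (length-filter-map P? f xs)
    ... | false = length-filter-map P? f xs

  module _ {A : Set} {P : Pred A 0ℓ} (P? : Decidable P) where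

    length-filter-++ : ∀ xs ys → length (filter P? (xs ++ ys)) ≡ length (filter P? xs) + length (filter P? ys)
    length-filter-++ xs ys = trans (cong length (filter-++ P? xs ys)) (length-++ (filter P? xs))

    length-filter-sameElements : {xs ys : List A} → Unique xs → Unique ys →
      (∀ {x} → x ∈ xs → x ∈ ys) → (∀ {x} → x ∈ ys → x ∈ xs) → length (filter P? xs) ≡ length (filter P? ys)
    length-filter-sameElements xs-unique ys-unique to from =
      unique∧set⇒length-≡ (Unique.filter⁺ P? xs-unique) (Unique.filter⁺ P? ys-unique)
        (λ x∈ → let x∈xs , px = ∈-filter⁻ P? x∈ in ∈-filter⁺ P? (to x∈xs) px)
        (λ x∈ → let x∈ys , px = ∈-filter⁻ P? x∈ in ∈-filter⁺ P? (from x∈ys) px)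

  module _ {A B : Set} {P : Pred A 0ℓ} {Q : Pred B 0ℓ} (P? : Decidable P) (Q? : Decidable Q) where

    length-filter-≡-by-inverses : {xs : List A} {ys : List B} → Unique xs → Unique ys →
      (f : A → B) (g : B → A) →
      (∀ {x} → x ∈ xs → P x → f x ∈ ys × Q (f x) × g (f x) ≡ x) →
      (∀ {y} → y ∈ ys → Q y → g y ∈ xs × P (g y) × f (g y) ≡ y) →
      length (filter P? xs) ≡ length (filter Q? ys)
    length-filter-≡-by-inverses {xs} {ys} xs-unique ys-unique f g fg gf = begin
      length (filter P? xs)          ≡⟨ length-map f (filter P? xs) ⟨
      length (map f (filter P? xs))  ≡⟨ unique∧set⇒length-≡ fP-unique (Unique.filter⁺ Q? ys-unique) to from ⟩
      length (filter Q? ys)          ∎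
      where
      open ≡-Reasoning
      fP-unique : Unique (map f (filter P? xs))
      fP-unique = map⁺-injectiveOn injective (Unique.filter⁺ P? xs-unique)
        where
        injective : ∀ {x x′} → x ∈ filter P? xs → x′ ∈ filter P? xs → f x ≡ f x′ → x ≡ x′
        injective x∈ x′∈ fx≡fx′ =
          let x∈xs , px = ∈-filter⁻ P? x∈ ; x′∈xs , px′ = ∈-filter⁻ P? x′∈
          in trans (sym (proj₂ (proj₂ (fg x∈xs px)))) (trans (cong g fx≡fx′) (proj₂ (proj₂ (fg x′∈xs px′))))
      to : ∀ {y} → y ∈ map f (filter P? xs) → y ∈ filter Q? ys
      to y∈ with ∈-map⁻ f y∈
      ... | x , x∈ , refl = let x∈xs , px = ∈-filter⁻ P? x∈ ; fx∈ys , qfx , _ = fg x∈xs px in ∈-filter⁺ Q? fx∈ys qfx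
      from : ∀ {y} → y ∈ filter Q? ys → y ∈ map f (filter P? xs)
      from y∈ = let y∈ys , qy = ∈-filter⁻ Q? y∈ ; gy∈xs , pgy , fgy≡y = gf y∈ys qy
                in subst (_∈ map f (filter P? xs)) fgy≡y (∈-map⁺ f (∈-filter⁺ P? gy∈xs pgy))

  module _ {A B C : Set} {P : Pred C 0ℓ} {Q : Pred A 0ℓ} {R : Pred B 0ℓ}
           (P? : Decidable P) (Q? : Decidable Q) (R? : Decidable R) where

    length-filter-cartesianProductWith : (f : A → B → C) → (∀ {a b} → P (f a b) ⇔ (Q a × R b)) →
      ∀ xs ys → length (filter P? (cartesianProductWith f xs ys)) ≡ length (filter Q? xs) * length (filter R? ys)
    length-filter-cartesianProductWith f P⇔Q×R [] ys = refl
    length-filter-cartesianProductWith f P⇔Q×R (x ∷ xs) ys = begin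
      length (filter P? (map (f x) ys ++ cartesianProductWith f xs ys))
        ≡⟨ length-filter-++ P? (map (f x) ys) _ ⟩
      length (filter P? (map (f x) ys)) + length (filter P? (cartesianProductWith f xs ys))
        ≡⟨ cong₂ _+_ (length-filter-map P? (f x) ys) (length-filter-cartesianProductWith f P⇔Q×R xs ys) ⟩
      length (filter (P? ∘ f x) ys) + length (filter Q? xs) * length (filter R? ys)
        ≡⟨ row ⟩
      length (filter Q? (x ∷ xs)) * length (filter R? ys) ∎
      where
      open ≡-Reasoning
      open Equivalence
      row : length (filter (P? ∘ f x) ys) + length (filter Q? xs) * length (filter R? ys)
          ≡ length (filter Q? (x ∷ xs)) * length (filter R? ys)
      row with Q? x
      ... | yes qx = cong (_+ _) (cong length (filter-≐ (P? ∘ f x) R? (proj₂ ∘ to P⇔Q×R , λ r → from P⇔Q×R (qx , r)) ys))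
      ... | no ¬qx = cong (_+ _) (cong length (filter-none (P? ∘ f x) (All.universal (λ _ p → ¬qx (proj₁ (to P⇔Q×R p))) ys)))

  module _ {A : Set} where

    allMaps-suc : ∀ k (xs : List A) → allMaps (suc k) xs ≡ cartesianProductWith _∷_ xs (allMaps k xs)
    allMaps-suc k xs = go xs
      where
      go : ∀ ys → concatMap (λ x → map (x ∷_) (allMaps k xs)) ys ≡ cartesianProductWith _∷_ ys (allMaps k xs)
      go [] = refl
      go (y ∷ ys) = cong (map (y ∷_) (allMaps k xs) ++_) (go ys)

    ∈-allMaps⁺ : ∀ {k xs} (ρ : Vec A k) → (∀ i → lookup ρ i ∈ xs) → ρ ∈ allMaps k xs
    ∈-allMaps⁺ [] _ = here refl
    ∈-allMaps⁺ {suc k} {xs} (x ∷ ρ) ρ∈ = subst (x ∷ ρ ∈_) (sym (allMaps-suc k xs))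
      (∈-cartesianProductWith⁺ _∷_ (ρ∈ Fin.zero) (∈-allMaps⁺ ρ (ρ∈ ∘ Fin.suc)))

    ∈-allMaps⁻ : ∀ {k xs} {ρ : Vec A k} → ρ ∈ allMaps k xs → ∀ i → lookup ρ i ∈ xs
    ∈-allMaps⁻ {suc k} {xs} {x ∷ ρ} x∷ρ∈ i
      with ∈-cartesianProductWith⁻ _∷_ xs (allMaps k xs) (subst (x ∷ ρ ∈_) (allMaps-suc k xs) x∷ρ∈)
    ∈-allMaps⁻ _ Fin.zero    | _ , _ , x∈xs , _ , refl = x∈xs
    ∈-allMaps⁻ _ (Fin.suc i) | _ , _ , _ , ρ∈ , refl = ∈-allMaps⁻ ρ∈ i

    allMaps⁺ : ∀ k {xs : List A} → Unique xs → Unique (allMaps k xs)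
    allMaps⁺ zero _ = All.[] ∷ []
    allMaps⁺ (suc k) {xs} xs-unique = subst Unique (sym (allMaps-suc k xs))
      (Unique.cartesianProductWith⁺ _∷_ ∷-injective xs-unique (allMaps⁺ k xs-unique))

    Everywhere : ∀ {k} → (Fin k → Pred A 0ℓ) → Pred (Vec A k) 0ℓ
    Everywhere B ρ = ∀ i → B i (lookup ρ i)

    everywhere? : ∀ {k} {B : Fin k → Pred A 0ℓ} → (∀ i → Decidable (B i)) → Decidable (Everywhere B)
    everywhere? B? ρ = all? (λ i → B? i (lookup ρ i))

    Everywhere-∷ : ∀ {k} {B : Fin (suc k) → Pred A 0ℓ} {x} {ρ} →
      Everywhere B (x ∷ ρ) ⇔ (B Fin.zero x × Everywhere (B ∘ Fin.suc) ρ)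
    Everywhere-∷ = mk⇔ (λ b → b Fin.zero , b ∘ Fin.suc) λ { (b₀ , b₊) Fin.zero → b₀ ; (b₀ , b₊) (Fin.suc i) → b₊ i }

    length-filter-allMaps : ∀ {k} {B : Fin k → Pred A 0ℓ} (B? : ∀ i → Decidable (B i)) (xs : List A) →
      length (filter (everywhere? B?) (allMaps k xs)) ≡ ∏ (λ i → length (filter (B? i) xs))
    length-filter-allMaps {zero} B? xs = refl
    length-filter-allMaps {suc k} {B} B? xs = begin
      length (filter (everywhere? B?) (allMaps (suc k) xs))
        ≡⟨ cong (length ∘ filter (everywhere? B?)) (allMaps-suc k xs) ⟩
      length (filter (everywhere? B?) (cartesianProductWith _∷_ xs (allMaps k xs)))
        ≡⟨ length-filter-cartesianProductWith (everywhere? B?) (B? Fin.zero) (everywhere? (B? ∘ Fin.suc)) _∷_ (Everywhere-∷ {B = B}) xs (allMaps k xs) ⟩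
      length (filter (B? Fin.zero) xs) * length (filter (everywhere? (B? ∘ Fin.suc)) (allMaps k xs))
        ≡⟨ cong (length (filter (B? Fin.zero) xs) *_) (length-filter-allMaps (B? ∘ Fin.suc) xs) ⟩
      ∏ (λ i → length (filter (B? i) xs)) ∎
      where open ≡-Reasoning

  module _ {A : Set} {P Q : Pred A 0ℓ} (P? : Decidable P) (Q? : Decidable Q) where

    length-filter-partition : ∀ xs → length (filter P? xs)
      ≡ length (filter (λ x → P? x ×-dec Q? x) xs) + length (filter (λ x → P? x ×-dec ¬? (Q? x)) xs)
    length-filter-partition [] = refl
    length-filter-partition (x ∷ xs) with P? x | Q? x
    ... | yes _ | yes _ = cong suc (length-filter-partition xs)
    ... | yes _ | no _  = trans (cong suc (length-filter-partition xs)) (sym (ℕₚ.+-suc _ _))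
    ... | no _  | _     = length-filter-partition xs

  count : ∀ {k} {P : Pred (Fin k) 0ℓ} → Decidable P → ℕ
  count {k} P? = length (filter P? (allFin k))

  module _ {k : ℕ} where

    count-suc : {P : Pred (Fin (suc k)) 0ℓ} (P? : Decidable P) → count P? ≡ 𝟙 (P? Fin.zero) + count (P? ∘ Fin.suc)
    count-suc P? = begin
      length (filter P? (Fin.zero ∷ tabulate Fin.suc))    ≡⟨ length-filter-∷ P? Fin.zero (tabulate Fin.suc) ⟩
      𝟙 (P? Fin.zero) + length (filter P? (tabulate Fin.suc)) ≡⟨ cong (𝟙 (P? Fin.zero) +_) suc-shift ⟩
      𝟙 (P? Fin.zero) + count (P? ∘ Fin.suc)               ∎
      where
      open ≡-Reasoning
      suc-shift : length (filter P? (tabulate Fin.suc)) ≡ count (P? ∘ Fin.suc)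
      suc-shift = trans (cong (length ∘ filter P?) (sym (map-tabulate (λ i → i) Fin.suc))) (length-filter-map P? Fin.suc (allFin k))

    count-cong : {P Q : Pred (Fin k) 0ℓ} (P? : Decidable P) (Q? : Decidable Q) → (∀ {i} → P i ⇔ Q i) → count P? ≡ count Q?
    count-cong P? Q? P⇔Q = cong length (filter-≐ P? Q? (Equivalence.to P⇔Q , Equivalence.from P⇔Q) (allFin k))

    count-pos : {P : Pred (Fin k) 0ℓ} (P? : Decidable P) → ∀ {i} → P i → 0 < count P?
    count-pos P? {i} pi = filter-some P? {allFin k} (Any.map (λ { refl → pi }) (∈-allFin i))

    hasCount⇒count : {P : Pred (Fin k) 0ℓ} (P? : Decidable P) → ∀ {c} → HasCount k P c → count P? ≡ c
    hasCount⇒count P? (L , L-unique , length-L , L-members) =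
      trans (unique∧set⇒length-≡ (Unique.filter⁺ P? (Unique.allFin⁺ k)) L-unique
              (λ i∈ → proj₂ (L-members _) (proj₂ (∈-filter⁻ P? {xs = allFin k} i∈)))
              (λ i∈L → ∈-filter⁺ P? (∈-allFin _) (proj₁ (L-members _) i∈L)))
            length-L

  count>0⇒∃ : ∀ {k} {P : Pred (Fin k) 0ℓ} (P? : Decidable P) → 0 < count P? → ∃ P
  count>0⇒∃ {k} {P} P? = go (allFin k)
    where
    go : ∀ xs → 0 < length (filter P? xs) → ∃ P
    go (x ∷ xs) nonempty with P? x
    ... | yes px = x , px
    ... | no _   = go xs nonempty

  ∏-^-count : ∀ {k} {P : Pred (Fin k) 0ℓ} (P? : Decidable P) a → ∏ (λ i → a ^ 𝟙 (P? i)) ≡ a ^ count P?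
  ∏-^-count {zero} P? a = refl
  ∏-^-count {suc k} P? a = begin
    a ^ 𝟙 (P? Fin.zero) * ∏ (λ i → a ^ 𝟙 (P? (Fin.suc i))) ≡⟨ cong (a ^ 𝟙 (P? Fin.zero) *_) (∏-^-count (P? ∘ Fin.suc) a) ⟩
    a ^ 𝟙 (P? Fin.zero) * a ^ count (P? ∘ Fin.suc)         ≡⟨ ℕₚ.^-distribˡ-+-* a (𝟙 (P? Fin.zero)) _ ⟨
    a ^ (𝟙 (P? Fin.zero) + count (P? ∘ Fin.suc))           ≡⟨ cong (a ^_) (count-suc P?) ⟨
    a ^ count P?                                            ∎
    where open ≡-Reasoning

module Sums where

  open import Data.Integer using (+_; -_; _+_; _-_; _*_; _^_; 0ℤ; 1ℤ; -1ℤ)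
  open import Data.Integer.Properties using (+-identityˡ; +-assoc; *-identityˡ; *-zeroˡ; *-zeroʳ; *-distribˡ-+; *-1-commutativeMonoid)
  open import Algebra.Properties.CommutativeMonoid.Sum *-1-commutativeMonoid
    public using () renaming (sum to ∏ᶻ; sum-cong-≗ to ∏ᶻ-cong)
  open import Data.Integer.Solver using (module +-*-Solver)

  sumℤ-map-++ : {A : Set} (f : A → ℤ) (xs ys : List A) → sumℤ (map f (xs ++ ys)) ≡ sumℤ (map f xs) + sumℤ (map f ys)
  sumℤ-map-++ f [] ys = sym (+-identityˡ _)
  sumℤ-map-++ f (x ∷ xs) ys = trans (cong (_+_ (f x)) (sumℤ-map-++ f xs ys)) (sym (+-assoc (f x) _ _))

  *-distribˡ-sumℤ : {A : Set} (c : ℤ) (f : A → ℤ) (xs : List A) → c * sumℤ (map f xs) ≡ sumℤ (map (λ x → c * f x) xs)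
  *-distribˡ-sumℤ c f [] = *-zeroʳ c
  *-distribˡ-sumℤ c f (x ∷ xs) = trans (*-distribˡ-+ c (f x) _) (cong (_+_ (c * f x)) (*-distribˡ-sumℤ c f xs))

  sumℤ-+ : {A : Set} (f g : A → ℤ) (xs : List A) → sumℤ (map (λ x → f x + g x) xs) ≡ sumℤ (map f xs) + sumℤ (map g xs)
  sumℤ-+ f g [] = refl
  sumℤ-+ f g (x ∷ xs) rewrite sumℤ-+ f g xs =
    solve 4 (λ a b c d → (a :+ b) :+ (c :+ d) := (a :+ c) :+ (b :+ d)) refl (f x) (g x) (sumℤ (map f xs)) (sumℤ (map g xs))
    where open +-*-Solver

  sumℤ-zero : {A : Set} (xs : List A) → sumℤ (map (λ _ → 0ℤ) xs) ≡ 0ℤ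
  sumℤ-zero [] = refl
  sumℤ-zero (x ∷ xs) = trans (+-identityˡ _) (sumℤ-zero xs)

  sumℤ-swap : {A B : Set} (F : A → B → ℤ) (xs : List A) (ys : List B) →
    sumℤ (map (λ x → sumℤ (map (F x) ys)) xs) ≡ sumℤ (map (λ y → sumℤ (map (λ x → F x y) xs)) ys)
  sumℤ-swap F [] ys = sym (sumℤ-zero ys)
  sumℤ-swap F (x ∷ xs) ys = trans (cong (_+_ (sumℤ (map (F x) ys))) (sumℤ-swap F xs ys))
    (sym (sumℤ-+ (F x) (λ y → sumℤ (map (λ x → F x y) xs)) ys))

  sumℤ-filter : {A : Set} {P : Pred A 0ℓ} (P? : Decidable P) (t : A → ℤ) (xs : List A) →
    sumℤ (map t (filter P? xs)) ≡ sumℤ (map (λ x → if does (P? x) then t x else 0ℤ) xs)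
  sumℤ-filter P? t [] = refl
  sumℤ-filter P? t (x ∷ xs) with does (P? x)
  ... | true  = cong (_+_ (t x)) (sumℤ-filter P? t xs)
  ... | false = trans (sumℤ-filter P? t xs) (sym (+-identityˡ _))

  length-filter≡sumℤ-𝟙 : {A : Set} {P : Pred A 0ℓ} (P? : Decidable P) (xs : List A) →
    + length (filter P? xs) ≡ sumℤ (map (λ x → + 𝟙 (P? x)) xs)
  length-filter≡sumℤ-𝟙 P? [] = refl
  length-filter≡sumℤ-𝟙 P? (x ∷ xs) with does (P? x)
  ... | true  = cong (_+_ 1ℤ) (length-filter≡sumℤ-𝟙 P? xs)
  ... | false = trans (length-filter≡sumℤ-𝟙 P? xs) (sym (+-identityˡ _))

  sumℤ-select : {A : Set} (_≟_ : DecidableEquality A) (g : A → ℤ) {j : A} {xs : List A} → Unique xs → j ∈ xs →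
    sumℤ (map (λ i → if does (j ≟ i) then g i else 0ℤ) xs) ≡ g j
  sumℤ-select _≟_ g {j} {x ∷ xs} (j∉xs ∷ xs-unique) (here refl) = begin
    (if does (j ≟ j) then g j else 0ℤ) + sumℤ (map (λ i → if does (j ≟ i) then g i else 0ℤ) xs)
      ≡⟨ cong₂ _+_ (cong (λ b → if b then g j else 0ℤ) (dec-true (j ≟ j) refl)) rest-zero ⟩
    g j + 0ℤ
      ≡⟨ ℤₚ.+-identityʳ (g j) ⟩
    g j ∎
    where
    open ≡-Reasoning
    rest-zero : sumℤ (map (λ i → if does (j ≟ i) then g i else 0ℤ) xs) ≡ 0ℤ
    rest-zero = trans (cong sumℤ (map-cong-local (All.map (λ j≢i → cong (λ b → if b then _ else 0ℤ) (dec-false (j ≟ _) j≢i)) j∉xs)))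
                      (sumℤ-zero xs)
  sumℤ-select _≟_ g {j} {x ∷ xs} (j∉xs ∷ xs-unique) (there j∈xs) =
    trans (cong (_+ _) (cong (λ b → if b then g x else 0ℤ) (dec-false (j ≟ x) λ { refl → All.lookup j∉xs j∈xs refl })))
          (trans (+-identityˡ _) (sumℤ-select _≟_ g xs-unique j∈xs))

  pos-^ : ∀ a k → + (a ℕ.^ k) ≡ (+ a) ^ k
  pos-^ a zero    = refl
  pos-^ a (suc k) = trans (ℤₚ.pos-* a (a ℕ.^ k)) (cong (_*_ (+ a)) (pos-^ a k))

  *-if : (a : ℤ) (b : Bool) {y : ℤ} → a * (if b then y else 0ℤ) ≡ (if b then a * y else 0ℤ)
  *-if a true  = refl
  *-if a false = *-zeroʳ a

  sumℤ-by-key : {A : Set} (key : A → ℕ) (w : ℕ → ℤ) (t : A → ℤ) (k : ℕ) (xs : List A) → All (λ x → key x ℕ.< k) xs →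
    sumℤ (map (λ i → w i * sumℤ (map t (filter (λ x → key x ℕ.≟ i) xs))) (upTo k)) ≡ sumℤ (map (λ x → w (key x) * t x) xs)
  sumℤ-by-key key w t k xs keys<k = begin
    sumℤ (map (λ i → w i * sumℤ (map t (filter (λ x → key x ℕ.≟ i) xs))) (upTo k))
      ≡⟨ cong sumℤ (map-cong (λ i → trans (cong (w i *_) (sumℤ-filter (λ x → key x ℕ.≟ i) t xs)) (*-distribˡ-sumℤ (w i) _ xs)) (upTo k)) ⟩
    sumℤ (map (λ i → sumℤ (map (λ x → w i * (if does (key x ℕ.≟ i) then t x else 0ℤ)) xs)) (upTo k))
      ≡⟨ sumℤ-swap (λ i x → w i * (if does (key x ℕ.≟ i) then t x else 0ℤ)) (upTo k) xs ⟩
    sumℤ (map (λ x → sumℤ (map (λ i → w i * (if does (key x ℕ.≟ i) then t x else 0ℤ)) (upTo k))) xs)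
      ≡⟨ cong sumℤ (map-cong-local (All.map select keys<k)) ⟩
    sumℤ (map (λ x → w (key x) * t x) xs) ∎
    where
    open ≡-Reasoning
    select : ∀ {x} → key x ℕ.< k → sumℤ (map (λ i → w i * (if does (key x ℕ.≟ i) then t x else 0ℤ)) (upTo k)) ≡ w (key x) * t x
    select {x} key<k = trans (cong sumℤ (map-cong (λ i → *-if (w i) (does (key x ℕ.≟ i))) (upTo k)))
                             (sumℤ-select ℕ._≟_ (λ i → w i * t x) (Unique.upTo⁺ k) (∈-upTo⁺ key<k))

  𝟙-all : ∀ {k} {P : Pred (Fin k) 0ℓ} (P? : Decidable P) → + 𝟙 (all? P?) ≡ ∏ᶻ (λ i → + 𝟙 (P? i))
  𝟙-all {zero} P? = refl
  𝟙-all {suc k} P? with P? Fin.zero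
  ... | yes _ = trans (𝟙-all (P? ∘ Fin.suc)) (sym (*-identityˡ _))
  ... | no _  = sym (*-zeroˡ (∏ᶻ (λ i → + 𝟙 (P? (Fin.suc i)))))

  𝟙-¬ : {A : Set} (a? : Dec A) → + 𝟙 (¬? a?) ≡ 1ℤ - + 𝟙 a?
  𝟙-¬ (yes _) = refl
  𝟙-¬ (no _)  = refl

  𝟙-→ : {A B : Set} (a? : Dec A) (b? : Dec B) → + 𝟙 (a? →-dec b?) ≡ (if does a? then + 𝟙 b? else 1ℤ)
  𝟙-→ (yes _) (yes _) = refl
  𝟙-→ (yes _) (no _)  = refl
  𝟙-→ (no _)  _       = refl

  subsets : ∀ k → List (Subset k)
  subsets k = allMaps k (inside ∷ outside ∷ [])

  ∏-1-minus : ∀ k (x : Fin k → ℤ) → ∏ᶻ (λ e → 1ℤ - x e)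
    ≡ sumℤ (map (λ Y → -1ℤ ^ ∣ Y ∣ * ∏ᶻ (λ e → if does (e ∈ₛ? Y) then x e else 1ℤ)) (subsets k))
  ∏-1-minus zero x = refl
  ∏-1-minus (suc k) x = begin
    (1ℤ - x₀) * ∏ᶻ (λ e → 1ℤ - x (Fin.suc e))
      ≡⟨ cong ((1ℤ - x₀) *_) (∏-1-minus k (x ∘ Fin.suc)) ⟩
    (1ℤ - x₀) * S
      ≡⟨ solve 2 (λ a s → (con 1ℤ :- a) :* s := (:- a) :* s :+ (s :+ con 0ℤ)) refl x₀ S ⟩
    (- x₀) * S + (S + 0ℤ)
      ≡⟨ cong₂ (λ u v → u + (v + 0ℤ))
           (trans (*-distribˡ-sumℤ (- x₀) T₊ (subsets k)) (cong sumℤ (trans (map-cong with-e₀ (subsets k)) (map-∘ (subsets k)))))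
           (cong sumℤ (trans (map-cong without-e₀ (subsets k)) (map-∘ (subsets k)))) ⟩
    sumℤ (map T (map (inside ∷_) (subsets k))) + (sumℤ (map T (map (outside ∷_) (subsets k))) + 0ℤ)
      ≡⟨ trans (sumℤ-map-++ T (map (inside ∷_) (subsets k)) _) (cong (_+_ (sumℤ (map T (map (inside ∷_) (subsets k))))) (sumℤ-map-++ T (map (outside ∷_) (subsets k)) [])) ⟨
    sumℤ (map T (subsets (suc k))) ∎
    where
    open ≡-Reasoning
    open +-*-Solver
    x₀ = x Fin.zero
    T : Subset (suc k) → ℤ
    T Y = -1ℤ ^ ∣ Y ∣ * ∏ᶻ (λ e → if does (e ∈ₛ? Y) then x e else 1ℤ)
    T₊ : Subset k → ℤ
    T₊ Y = -1ℤ ^ ∣ Y ∣ * ∏ᶻ (λ e → if does (e ∈ₛ? Y) then x (Fin.suc e) else 1ℤ)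
    S = sumℤ (map T₊ (subsets k))
    with-e₀ : ∀ Y → (- x₀) * T₊ Y ≡ T (inside ∷ Y)
    with-e₀ Y = solve 3 (λ a s p → (:- a) :* (s :* p) := (con -1ℤ :* s) :* (a :* p)) refl x₀ (-1ℤ ^ ∣ Y ∣) _
    without-e₀ : ∀ Y → T₊ Y ≡ T (outside ∷ Y)
    without-e₀ Y = solve 2 (λ s p → s :* p := s :* (con 1ℤ :* p)) refl (-1ℤ ^ ∣ Y ∣) _

module Improper (G : SignedGraph) where

  open import Data.Integer using (+_; _*_; _^_; -1ℤ; 1ℤ; _-_)
  open Sums

  Colouring : Set
  Colouring = Vec ℤ (n G)

  ImproperAt : Fin (m G) → Pred Colouring 0ℓ
  ImproperAt e κ = lookup κ (proj₁ (ends G e)) ≡ applySign (σ G e) (lookup κ (proj₂ (ends G e)))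

  improperAt? : ∀ e → Decidable (ImproperAt e)
  improperAt? e κ = lookup κ (proj₁ (ends G e)) ℤ.≟ applySign (σ G e) (lookup κ (proj₂ (ends G e)))

  ImproperOn : Subset (m G) → Pred Colouring 0ℓ
  ImproperOn Y κ = ∀ e → e ∈ₛ Y → ImproperAt e κ

  improperOn? : ∀ Y → Decidable (ImproperOn Y)
  improperOn? Y κ = all? (λ e → (e ∈ₛ? Y) →-dec improperAt? e κ)

  numProper-inclusion–exclusion : ∀ C → + numProper G C
    ≡ sumℤ (map (λ Y → -1ℤ ^ ∣ Y ∣ * + length (filter (improperOn? Y) (allMaps (n G) C))) (subsets (m G)))
  numProper-inclusion–exclusion C = begin
    + length (filter (proper? G) L)
      ≡⟨ length-filter≡sumℤ-𝟙 (proper? G) L ⟩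
    sumℤ (map (λ κ → + 𝟙 (proper? G κ)) L)
      ≡⟨ cong sumℤ (map-cong (λ κ → trans (𝟙-all (λ e → ¬? (improperAt? e κ))) (∏ᶻ-cong (λ e → 𝟙-¬ (improperAt? e κ)))) L) ⟩
    sumℤ (map (λ κ → ∏ᶻ (λ e → 1ℤ - + 𝟙 (improperAt? e κ))) L)
      ≡⟨ cong sumℤ (map-cong (λ κ → ∏-1-minus (m G) (λ e → + 𝟙 (improperAt? e κ))) L) ⟩
    sumℤ (map (λ κ → sumℤ (map (λ Y → -1ℤ ^ ∣ Y ∣ * F Y κ) (subsets (m G)))) L)
      ≡⟨ sumℤ-swap (λ κ Y → -1ℤ ^ ∣ Y ∣ * F Y κ) L (subsets (m G)) ⟩
    sumℤ (map (λ Y → sumℤ (map (λ κ → -1ℤ ^ ∣ Y ∣ * F Y κ) L)) (subsets (m G)))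
      ≡⟨ cong sumℤ (map-cong per-subset (subsets (m G))) ⟩
    sumℤ (map (λ Y → -1ℤ ^ ∣ Y ∣ * + length (filter (improperOn? Y) L)) (subsets (m G))) ∎
    where
    open ≡-Reasoning
    L = allMaps (n G) C
    F : Subset (m G) → Colouring → ℤ
    F Y κ = ∏ᶻ (λ e → if does (e ∈ₛ? Y) then + 𝟙 (improperAt? e κ) else 1ℤ)
    per-subset : ∀ Y → sumℤ (map (λ κ → -1ℤ ^ ∣ Y ∣ * F Y κ) L) ≡ -1ℤ ^ ∣ Y ∣ * + length (filter (improperOn? Y) L)
    per-subset Y = begin
      sumℤ (map (λ κ → -1ℤ ^ ∣ Y ∣ * F Y κ) L)            ≡⟨ *-distribˡ-sumℤ (-1ℤ ^ ∣ Y ∣) (F Y) L ⟨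
      -1ℤ ^ ∣ Y ∣ * sumℤ (map (F Y) L)                    ≡⟨ cong (-1ℤ ^ ∣ Y ∣ *_) (cong sumℤ (map-cong F≡𝟙 L)) ⟩
      -1ℤ ^ ∣ Y ∣ * sumℤ (map (λ κ → + 𝟙 (improperOn? Y κ)) L) ≡⟨ cong (-1ℤ ^ ∣ Y ∣ *_) (length-filter≡sumℤ-𝟙 (improperOn? Y) L) ⟨
      -1ℤ ^ ∣ Y ∣ * + length (filter (improperOn? Y) L)   ∎
      where
      F≡𝟙 : ∀ κ → F Y κ ≡ + 𝟙 (improperOn? Y κ)
      F≡𝟙 κ = sym (trans (𝟙-all (λ e → (e ∈ₛ? Y) →-dec improperAt? e κ)) (∏ᶻ-cong (λ e → 𝟙-→ (e ∈ₛ? Y) (improperAt? e κ))))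

module Switching where

  open import Data.Integer using (+_; -[1+_]; -_; 0ℤ)
  open import Data.Integer.Properties using (neg-involutive)
  open import Data.Parity.Base using (Parity; 0ℙ; 1ℙ; _+_)

  switch : Parity → ℤ → ℤ
  switch 0ℙ x = x
  switch 1ℙ x = - x

  switch-+ : ∀ p q x → switch (p + q) x ≡ switch q (switch p x)
  switch-+ 0ℙ q  x = refl
  switch-+ 1ℙ 0ℙ x = refl
  switch-+ 1ℙ 1ℙ x = sym (neg-involutive x)

  switch-involutive : ∀ p x → switch p (switch p x) ≡ x
  switch-involutive 0ℙ x = refl
  switch-involutive 1ℙ x = neg-involutive x

  switch-0ℤ : ∀ p → switch p 0ℤ ≡ 0ℤ
  switch-0ℤ 0ℙ = refl
  switch-0ℤ 1ℙ = refl

  switch≡0ℤ⇒≡0ℤ : ∀ p {x} → switch p x ≡ 0ℤ → x ≡ 0ℤ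
  switch≡0ℤ⇒≡0ℤ 0ℙ eq = eq
  switch≡0ℤ⇒≡0ℤ 1ℙ {x} eq = trans (sym (neg-involutive x)) (cong -_ eq)

  ≡-x⇒≡0ℤ : ∀ {x} → x ≡ - x → x ≡ 0ℤ
  ≡-x⇒≡0ℤ {+ zero} _ = refl
  ≡-x⇒≡0ℤ {+ suc _} ()
  ≡-x⇒≡0ℤ { -[1+ _ ]} ()

  switch-∈ : ∀ p {x} {xs : List ℤ} → x ∈ xs → - x ∈ xs → switch p x ∈ xs
  switch-∈ 0ℙ x∈xs _   = x∈xs
  switch-∈ 1ℙ _   -x∈xs = -x∈xs

module Walks (G : SignedGraph) (Y : Subset (m G)) where

  open import Data.Nat using (_+_; _≤_; _<_; parity)
  open import Data.Nat.Properties using (+-assoc; +-comm; +-identityʳ; ≤-refl)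
  open import Data.Integer using (-_; 0ℤ)
  open import Data.Integer.Properties using (neg-involutive)
  open import Data.Parity.Base as ℙ using (Parity; 0ℙ; 1ℙ)
  open import Data.Parity.Properties using (+-homo-+)
  open import Relation.Binary.Construct.Closure.ReflexiveTransitive using (ε; _◅_; _◅◅_; revApp; reverse)
  open import Relation.Binary.Definitions using (Sym)
  open Counting
  open Arithmetic
  open Switching
  open Improper G

  V : Set
  V = Fin (n G)

  Walk : V → V → Set
  Walk = Conn G Y

  steps : ∀ {u w} → Walk u w → ℕ
  steps ε       = 0
  steps (_ ◅ W) = suc (steps W)

  signCount : Sign → ℕ
  signCount s = if isNeg s then 1 else 0

  negatives : ∀ {u w} → Walk u w → ℕ
  negatives ε             = 0
  negatives ((e , _) ◅ W) = signCount (σ G e) + negatives W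

  signParity : Sign → Parity
  signParity s = parity (signCount s)

  Negative : ∀ {u w} → Walk u w → Set
  Negative W = parity (negatives W) ≡ 1ℙ

  steps-◅◅ : ∀ {u v w} (W : Walk u v) (W′ : Walk v w) → steps (W ◅◅ W′) ≡ steps W + steps W′
  steps-◅◅ ε       W′ = refl
  steps-◅◅ (_ ◅ W) W′ = cong suc (steps-◅◅ W W′)

  negatives-◅◅ : ∀ {u v w} (W : Walk u v) (W′ : Walk v w) → negatives (W ◅◅ W′) ≡ negatives W + negatives W′
  negatives-◅◅ ε             W′ = refl
  negatives-◅◅ ((e , _) ◅ W) W′ =
    trans (cong (signCount (σ G e) +_) (negatives-◅◅ W W′)) (sym (+-assoc (signCount (σ G e)) _ _))

  parity-◅◅ : ∀ {u v w} (W : Walk u v) (W′ : Walk v w) →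
    parity (negatives (W ◅◅ W′)) ≡ parity (negatives W) ℙ.+ parity (negatives W′)
  parity-◅◅ W W′ = trans (cong parity (negatives-◅◅ W W′)) (+-homo-+ (negatives W) (negatives W′))

  Joins-sym : ∀ {e u v} → Joins G e u v → Joins G e v u
  Joins-sym (inj₁ ends≡) = inj₂ ends≡
  Joins-sym (inj₂ ends≡) = inj₁ ends≡

  Adj-sym : Sym (Adj G Y) (Adj G Y)
  Adj-sym (e , e∈Y , joins) = e , e∈Y , Joins-sym joins

  negatives-revApp : ∀ {u v w} (W : Walk v u) (W′ : Walk v w) →
    negatives (revApp Adj-sym W W′) ≡ negatives W + negatives W′
  negatives-revApp ε W′ = refl
  negatives-revApp ((e , _) ◅ W) W′ = begin
    negatives (revApp Adj-sym W (_ ◅ W′))       ≡⟨ negatives-revApp W _ ⟩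
    negatives W + (signCount (σ G e) + negatives W′) ≡⟨ +-assoc (negatives W) _ _ ⟨
    negatives W + signCount (σ G e) + negatives W′   ≡⟨ cong (_+ negatives W′) (+-comm (negatives W) _) ⟩
    signCount (σ G e) + negatives W + negatives W′   ∎
    where open ≡-Reasoning

  negatives-reverse : ∀ {u w} (W : Walk u w) → negatives (reverse Adj-sym W) ≡ negatives W
  negatives-reverse W = trans (negatives-revApp W ε) (+-identityʳ (negatives W))

  negatives-subst : ∀ {u v w} (v≡w : v ≡ w) (W : Walk u v) → negatives (subst (Walk u) v≡w W) ≡ negatives W
  negatives-subst refl W = refl

  edge : ∀ {e} → e ∈ₛ Y → Walk (proj₁ (ends G e)) (proj₂ (ends G e))
  edge {e} e∈Y = (e , e∈Y , inj₁ refl) ◅ ε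

  applySign≗switch : ∀ s x → applySign s x ≡ switch (signParity s) x
  applySign≗switch pos x = refl
  applySign≗switch neg x = refl

  module _ {κ : Colouring} (improper : ImproperOn Y κ) where

    edge-transport : ∀ {e u v} → e ∈ₛ Y → Joins G e u v → lookup κ v ≡ applySign (σ G e) (lookup κ u)
    edge-transport {e} e∈Y (inj₁ refl) = begin
      lookup κ (proj₂ (ends G e))                                        ≡⟨ switch-involutive s _ ⟨
      switch s (switch s (lookup κ (proj₂ (ends G e))))                   ≡⟨ cong (switch s) (trans (sym (applySign≗switch (σ G e) _)) (sym (improper e e∈Y))) ⟩
      switch s (lookup κ (proj₁ (ends G e)))                              ≡⟨ applySign≗switch (σ G e) _ ⟨
      applySign (σ G e) (lookup κ (proj₁ (ends G e)))                     ∎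
      where
      open ≡-Reasoning
      s = signParity (σ G e)
    edge-transport {e} e∈Y (inj₂ refl) = improper e e∈Y

    walk-transport : ∀ {u w} (W : Walk u w) → lookup κ w ≡ switch (parity (negatives W)) (lookup κ u)
    walk-transport ε = refl
    walk-transport {u} ((e , e∈Y , joins) ◅ W) = begin
      _                                                                   ≡⟨ walk-transport W ⟩
      switch (parity (negatives W)) (lookup κ _)                          ≡⟨ cong (switch (parity (negatives W))) (trans (edge-transport e∈Y joins) (applySign≗switch (σ G e) _)) ⟩
      switch (parity (negatives W)) (switch (signParity (σ G e)) (lookup κ u)) ≡⟨ switch-+ (signParity (σ G e)) _ _ ⟨
      switch (signParity (σ G e) ℙ.+ parity (negatives W)) (lookup κ u) ≡⟨ cong (λ p → switch p (lookup κ u)) (+-homo-+ (signCount (σ G e)) (negatives W)) ⟨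
      switch (parity (negatives ((e , e∈Y , joins) ◅ W))) (lookup κ u)    ∎
      where open ≡-Reasoning

  _∈ᵥ_ : ∀ {u w} → V → Walk u w → Set
  x ∈ᵥ ε               = ⊥
  x ∈ᵥ (_◅_ {u} _ W) = x ≡ u ⊎ x ∈ᵥ W

  _∈ᵥ?_ : ∀ {u w} x (W : Walk u w) → Dec (x ∈ᵥ W)
  x ∈ᵥ? ε               = no λ ()
  x ∈ᵥ? (_◅_ {u} _ W) = (x Fin.≟ u) ⊎-dec (x ∈ᵥ? W)

  Distinct : ∀ {u w} → Walk u w → Set
  Distinct ε               = ⊤
  Distinct (_◅_ {u} _ W) = ¬ u ∈ᵥ W × Distinct W

  split : ∀ {x u w} (W : Walk u w) → x ∈ᵥ W →
    Σ (Walk u x) λ A → Σ (Walk x w) λ B → 0 < steps B × W ≡ A ◅◅ B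
  split (a ◅ W) (inj₁ refl) = ε , a ◅ W , s≤s z≤n , refl
  split (a ◅ W) (inj₂ x∈W) with split W x∈W
  ... | A , B , B⁺ , W≡A◅◅B = a ◅ A , B , B⁺ , cong (a ◅_) W≡A◅◅B

  record Shortcut {u w} (W : Walk u w) : Set where
    field
      hub           : V
      prefix        : Walk u hub
      loop          : Walk hub hub
      suffix        : Walk hub w
      loop-nonempty : 0 < steps loop
      rest-nonempty : 0 < steps prefix + steps suffix
      decomposition : W ≡ prefix ◅◅ (loop ◅◅ suffix)

  module _ {u w} {W : Walk u w} (s : Shortcut W) where

    open Shortcut s

    steps-shortcut : steps W ≡ steps prefix + (steps loop + steps suffix)
    steps-shortcut = trans (cong steps decomposition)
      (trans (steps-◅◅ prefix (loop ◅◅ suffix)) (cong (steps prefix +_) (steps-◅◅ loop suffix)))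

    parity-shortcut : parity (negatives W)
      ≡ parity (negatives prefix) ℙ.+ (parity (negatives loop) ℙ.+ parity (negatives suffix))
    parity-shortcut = trans (cong (parity ∘ negatives) decomposition)
      (trans (parity-◅◅ prefix (loop ◅◅ suffix)) (cong (parity (negatives prefix) ℙ.+_) (parity-◅◅ loop suffix)))

  distinct-or-shortcut : ∀ {u w} (W : Walk u w) → Distinct W ⊎ Shortcut W
  distinct-or-shortcut ε = inj₁ tt
  distinct-or-shortcut (_◅_ {u} a W) with distinct-or-shortcut W
  ... | inj₂ s = inj₂ record
    { prefix = a ◅ prefix ; loop = loop ; suffix = suffix ; loop-nonempty = loop-nonempty
    ; rest-nonempty = s≤s z≤n ; decomposition = cong (a ◅_) decomposition }
    where open Shortcut s
  ... | inj₁ W-distinct with u ∈ᵥ? W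
  ...   | no u∉W = inj₁ (u∉W , W-distinct)
  ...   | yes u∈W with split W u∈W
  ...     | A , B , B⁺ , W≡A◅◅B = inj₂ record
    { prefix = ε ; loop = a ◅ A ; suffix = B ; loop-nonempty = s≤s z≤n
    ; rest-nonempty = B⁺ ; decomposition = cong (a ◅_) W≡A◅◅B }

  vertexAt : ∀ {u w} (W : Walk u w) → Fin (suc (steps W)) → V
  vertexAt {u} W       Fin.zero    = u
  vertexAt (_ ◅ W)     (Fin.suc i) = vertexAt W i

  edgeAt : ∀ {u w} (W : Walk u w) → Fin (steps W) → Fin (m G)
  edgeAt ((e , _) ◅ W) Fin.zero    = e
  edgeAt (_ ◅ W)       (Fin.suc i) = edgeAt W i

  vertexAt-last : ∀ {u w} (W : Walk u w) → vertexAt W (Fin.fromℕ (steps W)) ≡ w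
  vertexAt-last ε       = refl
  vertexAt-last (_ ◅ W) = vertexAt-last W

  edgeAt-∈ : ∀ {u w} (W : Walk u w) i → edgeAt W i ∈ₛ Y
  edgeAt-∈ ((_ , e∈Y , _) ◅ W) Fin.zero    = e∈Y
  edgeAt-∈ (_ ◅ W)              (Fin.suc i) = edgeAt-∈ W i

  edgeAt-joins : ∀ {u w} (W : Walk u w) i → Joins G (edgeAt W i) (vertexAt W (Fin.inject₁ i)) (vertexAt W (Fin.suc i))
  edgeAt-joins ((_ , _ , joins) ◅ W) Fin.zero    = joins
  edgeAt-joins (_ ◅ W)                (Fin.suc i) = edgeAt-joins W i

  vertexAt-∈ᵥ : ∀ {u w} (W : Walk u w) i → vertexAt W (Fin.inject₁ i) ∈ᵥ W
  vertexAt-∈ᵥ (_ ◅ W) Fin.zero    = inj₁ refl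
  vertexAt-∈ᵥ (_ ◅ W) (Fin.suc i) = inj₂ (vertexAt-∈ᵥ W i)

  distinct⇒vertexAt-injective : ∀ {u w} (W : Walk u w) → Distinct W →
    ∀ i j → vertexAt W (Fin.inject₁ i) ≡ vertexAt W (Fin.inject₁ j) → i ≡ j
  distinct⇒vertexAt-injective (_ ◅ W) _           Fin.zero    Fin.zero    _  = refl
  distinct⇒vertexAt-injective (_ ◅ W) (u∉W , _)   Fin.zero    (Fin.suc j) eq = contradiction (subst (_∈ᵥ W) (sym eq) (vertexAt-∈ᵥ W j)) u∉W
  distinct⇒vertexAt-injective (_ ◅ W) (u∉W , _)   (Fin.suc i) Fin.zero    eq = contradiction (subst (_∈ᵥ W) eq (vertexAt-∈ᵥ W i)) u∉W
  distinct⇒vertexAt-injective (_ ◅ W) (_ , W-dis) (Fin.suc i) (Fin.suc j) eq = cong Fin.suc (distinct⇒vertexAt-injective W W-dis i j eq)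

  negativeEdgeCount : ∀ k → (Fin k → Fin (m G)) → ℕ
  negativeEdgeCount k es = length (filterᵇ (λ i → isNeg (σ G (es i))) (allFin k))

  negativeEdgeCount-edgeAt : ∀ {u w} (W : Walk u w) → negativeEdgeCount (steps W) (edgeAt W) ≡ negatives W
  negativeEdgeCount-edgeAt ε = refl
  negativeEdgeCount-edgeAt ((e , _) ◅ W) =
    trans (count-suc (T? ∘ λ i → isNeg (σ G (edgeAt ((e , _) ◅ W) i)))) (cong (signCount (σ G e) +_) (negativeEdgeCount-edgeAt W))

  Joins-loopless : ∀ {e x} → ¬ Joins G e x x
  Joins-loopless {e} (inj₁ ends≡) = loopless G e (trans (cong proj₁ ends≡) (sym (cong proj₂ ends≡)))
  Joins-loopless {e} (inj₂ ends≡) = loopless G e (trans (cong proj₁ ends≡) (sym (cong proj₂ ends≡)))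

  Joins-unique : ∀ {e e′ u v} → Joins G e u v → Joins G e′ u v → e ≡ e′
  Joins-unique {e} {e′} (inj₁ refl) joins′ = simple G e e′ joins′
  Joins-unique {e} {e′} (inj₂ refl) joins′ = simple G e e′ (Joins-sym joins′)

  signCount-twice-even : ∀ s → parity (signCount s + (signCount s + 0)) ≡ 0ℙ
  signCount-twice-even pos = refl
  signCount-twice-even neg = refl

  distinct⇒negCycle : ∀ {r x} → Conn G Y r x → (W : Walk x x) → Distinct W → Negative W → NegCycle G Y r
  distinct⇒negCycle c ε _ ()
  distinct⇒negCycle c ((_ , _ , joins) ◅ ε) _ _ = contradiction joins Joins-loopless
  distinct⇒negCycle c ((e , _ , joins) ◅ (e′ , _ , joins′) ◅ ε) _ negative
    with Joins-unique joins (Joins-sym joins′)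
  ... | refl = contradiction (trans (sym (signCount-twice-even (σ G e))) negative) λ ()
  distinct⇒negCycle c W@(_ ◅ _ ◅ _ ◅ _) W-distinct negative = record
    { k        = steps W
    ; long     = s≤s (s≤s (s≤s z≤n))
    ; ws       = vertexAt W
    ; closed   = vertexAt-last W
    ; distinct = distinct⇒vertexAt-injective W W-distinct
    ; es       = edgeAt W
    ; esInY    = edgeAt-∈ W
    ; esJoin   = edgeAt-joins W
    ; inComp   = c
    ; negative = parity≡1ℙ⇒%2≡1 (negativeEdgeCount (steps W) (edgeAt W)) (trans (cong parity (negativeEdgeCount-edgeAt W)) negative)
    }

  -- A repeated vertex splits a closed walk into a nonempty loop and a nonempty rest; one of the
  -- two is negative, and it is shorter.
  negative⇒negCycle : ∀ {r x} → Conn G Y r x → (W : Walk x x) → Negative W → NegCycle G Y r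
  negative⇒negCycle c W = shorten (steps W) c W ≤-refl
    where
    shorten : ∀ fuel {r x} → Conn G Y r x → (W : Walk x x) → steps W ≤ fuel → Negative W → NegCycle G Y r
    shorten zero c ε _ ()
    shorten (suc fuel) c W W≤ negative with distinct-or-shortcut W
    ... | inj₁ W-distinct = distinct⇒negCycle c W W-distinct negative
    ... | inj₂ s with parity (negatives (Shortcut.loop s)) in loop-parity
    ...   | 1ℙ = shorten fuel (c ◅◅ prefix) loop
                   (a+[b+c]≤1+f⇒b≤f (steps prefix) _ _ (subst (_≤ suc fuel) (steps-shortcut s) W≤) rest-nonempty)
                   loop-parity
      where open Shortcut s
    ...   | 0ℙ = shorten fuel c (prefix ◅◅ suffix)
                   (subst (_≤ fuel) (sym (steps-◅◅ prefix suffix))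
                     (a+[b+c]≤1+f⇒a+c≤f (steps prefix) _ _ (subst (_≤ suc fuel) (steps-shortcut s) W≤) loop-nonempty))
                   (trans (parity-◅◅ prefix suffix)
                     (trans (cong (λ p → parity (negatives prefix) ℙ.+ (p ℙ.+ parity (negatives suffix))) (sym loop-parity))
                       (trans (sym (parity-shortcut s)) negative)))
      where open Shortcut s

  walkAlong : ∀ k (ws : Fin (suc k) → V) (es : Fin k → Fin (m G)) → (∀ i → es i ∈ₛ Y) →
    (∀ i → Joins G (es i) (ws (Fin.inject₁ i)) (ws (Fin.suc i))) →
    Σ (Walk (ws Fin.zero) (ws (Fin.fromℕ k))) λ W → negatives W ≡ negativeEdgeCount k es
  walkAlong zero ws es es∈Y es-join = ε , refl
  walkAlong (suc k) ws es es∈Y es-join with walkAlong k (ws ∘ Fin.suc) (es ∘ Fin.suc) (es∈Y ∘ Fin.suc) (es-join ∘ Fin.suc)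
  ... | W , W-negatives = (es Fin.zero , es∈Y Fin.zero , es-join Fin.zero) ◅ W ,
    trans (cong (signCount (σ G (es Fin.zero)) +_) W-negatives) (sym (count-suc (T? ∘ λ i → isNeg (σ G (es i)))))

  negCycle⇒negative : ∀ {r} → NegCycle G Y r → Σ V λ x → Conn G Y r x × Σ (Walk x x) Negative
  negCycle⇒negative nc with walkAlong k ws es esInY esJoin
    where open NegCycle nc
  ... | W , W-negatives = ws Fin.zero , inComp , subst (Walk (ws Fin.zero)) closed W ,
    trans (cong parity (trans (negatives-subst closed W) W-negatives)) (%2≡1⇒parity≡1ℙ (negativeEdgeCount k es) negative)
    where open NegCycle nc

  endpoint-conn : ∀ {r e u v} → Conn G Y r u → e ∈ₛ Y → Joins G e u v → Conn G Y r (proj₁ (ends G e))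
  endpoint-conn c e∈Y (inj₁ refl) = c
  endpoint-conn c e∈Y (inj₂ refl) = c ◅◅ ((_ , e∈Y , inj₂ refl) ◅ ε)

  allPos⇒negatives≡0 : ∀ {r u w} → AllPosComp G Y r → Conn G Y r u → (W : Walk u w) → negatives W ≡ 0
  allPos⇒negatives≡0 allPos c ε = refl
  allPos⇒negatives≡0 allPos c ((e , e∈Y , joins) ◅ W)
    rewrite allPos e e∈Y (endpoint-conn c e∈Y joins) = allPos⇒negatives≡0 allPos (c ◅◅ ((e , e∈Y , joins) ◅ ε)) W

  allPos⇒balanced : ∀ {r} → AllPosComp G Y r → BalancedComp G Y r
  allPos⇒balanced allPos nc with negCycle⇒negative nc
  ... | _ , c , W , negative = contradiction (trans (sym (cong parity (allPos⇒negatives≡0 allPos c W))) negative) λ ()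

  negCycle⇒colour≡0 : ∀ κ {r} → ImproperOn Y κ → NegCycle G Y r → lookup κ r ≡ 0ℤ
  negCycle⇒colour≡0 κ improper nc with negCycle⇒negative nc
  ... | x , c , W , negative = switch≡0ℤ⇒≡0ℤ (parity (negatives c)) (trans (sym (walk-transport {κ} improper c)) κx≡0)
    where
    κx≡0 : lookup κ x ≡ 0ℤ
    κx≡0 = ≡-x⇒≡0ℤ (trans (walk-transport {κ} improper W) (cong (λ p → switch p (lookup κ x)) negative))

  negativeEdge⇒negated-colour : ∀ κ {v e} → ImproperOn Y κ → e ∈ₛ Y → σ G e ≡ neg → Conn G Y v (proj₁ (ends G e)) →
    - lookup κ v ≡ lookup κ (proj₁ (ends G e)) ⊎ - lookup κ v ≡ lookup κ (proj₂ (ends G e))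
  negativeEdge⇒negated-colour κ {v} {e} improper e∈Y σe≡neg c with parity (negatives c) | walk-transport {κ} improper c
  ... | 1ℙ | κa≡-κv = inj₁ (sym κa≡-κv)
  ... | 0ℙ | κa≡κv  = inj₂ (begin
    - lookup κ v                                 ≡⟨ cong -_ (trans (sym κa≡κv) (improper e e∈Y)) ⟩
    - applySign (σ G e) (lookup κ (proj₂ (ends G e))) ≡⟨ cong (λ s → - applySign s _) σe≡neg ⟩
    - (- lookup κ (proj₂ (ends G e)))            ≡⟨ neg-involutive _ ⟩
    lookup κ (proj₂ (ends G e))                  ∎)
    where open ≡-Reasoning

module Components (G : SignedGraph) (Y : Subset (m G)) (conn? : ∀ v w → Dec (Conn G Y v w)) where

  open import Data.Nat using (_+_; parity)
  open import Data.Parity.Base as ℙ using (Parity; 0ℙ; 1ℙ)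
  open import Data.Parity.Properties using (+-homo-+; +-assoc; +-comm)
  open import Data.Fin.Properties using (≤-antisym)
  open import Relation.Binary.Construct.Closure.ReflexiveTransitive using (ε; _◅_; _◅◅_; reverse)
  open import Relation.Nullary.Decidable using (map′)
  open Improper G
  open Arithmetic
  open Walks G Y
  open Switching

  Conn-sym : ∀ {v w} → Conn G Y v w → Conn G Y w v
  Conn-sym = reverse Adj-sym

  rep : V → V
  rep v = proj₁ (least (conn? v) ε)

  rep-conn : ∀ v → Conn G Y v (rep v)
  rep-conn v = proj₁ (proj₂ (least (conn? v) ε))

  rep-minimal : ∀ {v w} → Conn G Y v w → rep v Fin.≤ w
  rep-minimal {v} = proj₂ (proj₂ (least (conn? v) ε))

  rep-cong : ∀ {v w} → Conn G Y v w → rep v ≡ rep w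
  rep-cong {v} {w} c = ≤-antisym (rep-minimal (c ◅◅ rep-conn w)) (rep-minimal (Conn-sym c ◅◅ rep-conn v))

  rep-idem : ∀ v → rep (rep v) ≡ rep v
  rep-idem v = sym (rep-cong (rep-conn v))

  Rep⇒rep≡ : ∀ {v} → Rep G Y v → rep v ≡ v
  Rep⇒rep≡ {v} v-rep = ≤-antisym (rep-minimal ε) (v-rep (rep v) (rep-conn v))

  rep≡⇒Rep : ∀ {v} → rep v ≡ v → Rep G Y v
  rep≡⇒Rep {v} rep≡v w c = subst (Fin._≤ w) rep≡v (rep-minimal c)

  Rep-rep : ∀ v → Rep G Y (rep v)
  Rep-rep v = rep≡⇒Rep (rep-idem v)

  rep? : Decidable (Rep G Y)
  rep? v = map′ rep≡⇒Rep Rep⇒rep≡ (rep v Fin.≟ v)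

  switching : V → Parity
  switching v = parity (negatives (rep-conn v))

  colour-via-rep : ∀ κ → ImproperOn Y κ → ∀ v → lookup κ v ≡ switch (switching v) (lookup κ (rep v))
  colour-via-rep κ improper v = begin
    lookup κ v                                                    ≡⟨ switch-involutive (switching v) _ ⟨
    switch (switching v) (switch (switching v) (lookup κ v))      ≡⟨ cong (switch (switching v)) (walk-transport {κ} improper (rep-conn v)) ⟨
    switch (switching v) (lookup κ (rep v))                       ∎
    where open ≡-Reasoning

  allPos⇒switching≡0ℙ : ∀ {v} → AllPosComp G Y (rep v) → switching v ≡ 0ℙ
  allPos⇒switching≡0ℙ {v} allPos = cong parity (allPos⇒negatives≡0 allPos (Conn-sym (rep-conn v)) (rep-conn v))

  balanced⇒switching≡0ℙ : ∀ {v} → Rep G Y v → BalancedComp G Y v → switching v ≡ 0ℙ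
  balanced⇒switching≡0ℙ {v} v-rep balanced with switching v in switching≡
  ... | 0ℙ = refl
  ... | 1ℙ = contradiction (negative⇒negCycle ε loop (trans (cong parity (negatives-subst (Rep⇒rep≡ v-rep) (rep-conn v))) switching≡)) balanced
    where
    loop : Walk v v
    loop = subst (Walk v) (Rep⇒rep≡ v-rep) (rep-conn v)

  walk-to-rep : ∀ {a b} → Conn G Y a b → Walk b (rep a)
  walk-to-rep {a} {b} c = subst (Walk b) (sym (rep-cong c)) (rep-conn b)

  edge-cycle : ∀ {e a b} → e ∈ₛ Y → Joins G e a b → Walk a a
  edge-cycle {e} {a} e∈Y joins = a→b ◅ (walk-to-rep (a→b ◅ ε) ◅◅ Conn-sym (rep-conn a))
    where
    a→b = e , e∈Y , joins

  parity-edge-cycle : ∀ {e a b} (e∈Y : e ∈ₛ Y) (joins : Joins G e a b) →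
    parity (negatives (edge-cycle e∈Y joins)) ≡ signParity (σ G e) ℙ.+ (switching b ℙ.+ switching a)
  parity-edge-cycle {e} {a} {b} e∈Y joins = begin
    parity (signCount (σ G e) + negatives (walk-to-rep a→b ◅◅ Conn-sym (rep-conn a)))
      ≡⟨ cong (λ k → parity (signCount (σ G e) + k)) (trans (negatives-◅◅ (walk-to-rep a→b) _)
           (cong₂ _+_ (negatives-subst (sym (rep-cong a→b)) (rep-conn b)) (negatives-reverse (rep-conn a)))) ⟩
    parity (signCount (σ G e) + (negatives (rep-conn b) + negatives (rep-conn a)))
      ≡⟨ +-homo-+ (signCount (σ G e)) _ ⟩
    signParity (σ G e) ℙ.+ parity (negatives (rep-conn b) + negatives (rep-conn a))
      ≡⟨ cong (signParity (σ G e) ℙ.+_) (+-homo-+ (negatives (rep-conn b)) _) ⟩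
    signParity (σ G e) ℙ.+ (switching b ℙ.+ switching a) ∎
    where
    open ≡-Reasoning
    a→b : Conn G Y a b
    a→b = (e , e∈Y , joins) ◅ ε

  balanced⇒switching-edge : ∀ {e a b} → BalancedComp G Y (rep a) → e ∈ₛ Y → Joins G e a b →
    switching a ≡ switching b ℙ.+ signParity (σ G e)
  balanced⇒switching-edge {e} {a} {b} balanced e∈Y joins with parity (negatives (edge-cycle e∈Y joins)) in cycle-parity
  ... | 1ℙ = contradiction (negative⇒negCycle (Conn-sym (rep-conn a)) (edge-cycle e∈Y joins) cycle-parity) balanced
  ... | 0ℙ = trans (p+q≡0ℙ⇒q≡p (signParity (σ G e) ℙ.+ switching b) (switching a)
                  (trans (+-assoc (signParity (σ G e)) _ _) (trans (sym (parity-edge-cycle e∈Y joins)) cycle-parity)))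
                 (+-comm (signParity (σ G e)) (switching b))

-- The value on [] is irrelevant: there are colourings with values in [] only if there are no vertices.
first : List ℤ → ℤ
first []      = ℤ.+ 0
first (x ∷ _) = x

first-∈ : ∀ {x xs} → x ∈ xs → first xs ∈ xs
first-∈ {xs = _ ∷ _} _ = here refl

module ColourCounts where

  open import Data.Nat using (_+_; _*_; _^_; _<_)
  open import Data.Nat.Properties using (*-identityˡ; ^-zeroˡ)
  open import Data.List.Membership.DecPropositional ℤ._≟_ using (_∈?_)
  open Arithmetic
  open Counting

  symmetricCount : List ℤ → ℕ
  symmetricCount C = length (filter (λ x → ℤ.- x ∈? C) C)

  zeroCount : List ℤ → ℕ
  zeroCount C = length (filter (ℤ._≟ ℤ.+ 0) C)

  firstCount : List ℤ → ℕ
  firstCount C = length (filter (ℤ._≟ first C) C)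

  firstCount≡1 : ∀ {x xs} → Unique (x ∷ xs) → firstCount (x ∷ xs) ≡ 1
  firstCount≡1 {x} {xs} (x∉xs ∷ _) = trans (length-filter-∷ (ℤ._≟ x) x xs)
    (cong₂ _+_ (𝟙-yes (x ℤ.≟ x) refl) (cong length (filter-none (ℤ._≟ x) (All.map (λ x≢y y≡x → x≢y (sym y≡x)) x∉xs))))

  -- firstCount C is the factor contributed by each non-representative: 1, unless C = [], in which
  -- case the other factors vanish as soon as there is a vertex.
  firstCount-factor : ∀ C → Unique C → ∀ k a b c → (0 < k → 0 < a + (b + c)) →
    firstCount C ^ k * (length C ^ a * (symmetricCount C ^ b * zeroCount C ^ c))
      ≡ length C ^ a * (symmetricCount C ^ b * zeroCount C ^ c)
  firstCount-factor C@(_ ∷ _) C-unique k a b c _ =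
    trans (cong (λ e → e ^ k * X) (firstCount≡1 C-unique)) (trans (cong (_* X) (^-zeroˡ k)) (*-identityˡ X))
    where X = length C ^ a * (symmetricCount C ^ b * zeroCount C ^ c)
  firstCount-factor [] _ zero    a b c _        = *-identityˡ _
  firstCount-factor [] _ (suc k) a b c k>0⇒abc>0 = sym (0^a*[0^b*0^c]≡0 a b c (k>0⇒abc>0 (s≤s z≤n)))

module ColourSets where

  open import Data.Nat using (_+_; _∸_; _≤_)
  open import Data.Nat.Properties using (+-identityʳ; +-comm; +-assoc; m∸n+n≡m)
  open import Data.Integer using (-_; 0ℤ)
  open import Data.Integer.Properties using (neg-involutive)
  open import Data.List.Membership.DecPropositional ℤ._≟_ using (_∈?_)
  open import Data.List.Membership.Propositional.Properties using (∈-++⁺ˡ; ∈-++⁺ʳ; ∈-++⁻)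
  import Data.Sum
  open Arithmetic
  open Counting
  open ColourCounts

  -- Z is [] or [0], according to the parity of λ − μ.
  module Decomposition {C P U Z : List ℤ}
    (C-unique : Unique C) (P-unique : Unique P) (U-unique : Unique U) (Z-unique : Unique Z)
    (P∩U : ∀ {x} → x ∈ P → x ∈ U → ⊥) (P≢0 : ∀ {x} → x ∈ P → x ≢ 0ℤ) (U≢0 : ∀ {x} → x ∈ U → x ≢ 0ℤ)
    (P-neg : ∀ {x} → x ∈ P → - x ∈ P) (U-neg : ∀ {x} → x ∈ U → - x ∈ U → ⊥) (Z≡0 : ∀ {x} → x ∈ Z → x ≡ 0ℤ)
    (C⊆PUZ : ∀ {x} → x ∈ C → x ∈ P ++ U ++ Z) (PUZ⊆C : ∀ {x} → x ∈ P ++ U ++ Z → x ∈ C) where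

    private
      PUZ-unique : Unique (P ++ U ++ Z)
      PUZ-unique = Unique.++⁺ P-unique (Unique.++⁺ U-unique Z-unique λ (x∈U , x∈Z) → U≢0 x∈U (Z≡0 x∈Z))
        λ (x∈P , x∈UZ) → [ P∩U x∈P , P≢0 x∈P ∘ Z≡0 ]′ (∈-++⁻ U x∈UZ)

      count-on-PUZ : ∀ {Q : Pred ℤ 0ℓ} (Q? : Decidable Q) →
        length (filter Q? C) ≡ length (filter Q? P) + (length (filter Q? U) + length (filter Q? Z))
      count-on-PUZ Q? = trans (length-filter-sameElements Q? C-unique PUZ-unique C⊆PUZ PUZ⊆C)
        (trans (length-filter-++ Q? P (U ++ Z)) (cong (length (filter Q? P) +_) (length-filter-++ Q? U Z)))

      length-filter-none : ∀ {Q : Pred ℤ 0ℓ} (Q? : Decidable Q) {xs} → (∀ {x} → x ∈ xs → ¬ Q x) → length (filter Q? xs) ≡ 0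
      length-filter-none Q? {xs} ¬Q = cong length (filter-none Q? (All.tabulate ¬Q))

      length-filter-all : ∀ {Q : Pred ℤ 0ℓ} (Q? : Decidable Q) {xs} → (∀ {x} → x ∈ xs → Q x) → length (filter Q? xs) ≡ length xs
      length-filter-all Q? {xs} allQ = cong length (filter-all Q? (All.tabulate allQ))

    length-decomposition : length C ≡ length P + (length U + length Z)
    length-decomposition = trans (unique∧set⇒length-≡ C-unique PUZ-unique C⊆PUZ PUZ⊆C)
      (trans (length-++ P) (cong (length P +_) (length-++ U)))

    symmetricCount-decomposition : symmetricCount C ≡ length P + length Z
    symmetricCount-decomposition = trans (count-on-PUZ (λ x → - x ∈? C))
      (cong₂ _+_ (length-filter-all _ (λ x∈P → PUZ⊆C (∈-++⁺ˡ (P-neg x∈P))))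
        (cong₂ _+_ (length-filter-none _ λ x∈U -x∈C → [ not-in-P x∈U , [ U-neg x∈U , not-in-Z x∈U ]′ ∘ ∈-++⁻ U ]′ (∈-++⁻ P (C⊆PUZ -x∈C)))
          (length-filter-all _ λ x∈Z → PUZ⊆C (∈-++⁺ʳ P (∈-++⁺ʳ U (subst (_∈ Z) (sym (trans (cong -_ (Z≡0 x∈Z)) (sym (Z≡0 x∈Z)))) x∈Z))))))
      where
      not-in-P : ∀ {x} → x ∈ U → - x ∈ P → ⊥
      not-in-P x∈U -x∈P = P∩U (subst (_∈ P) (neg-involutive _) (P-neg -x∈P)) x∈U
      not-in-Z : ∀ {x} → x ∈ U → - x ∈ Z → ⊥
      not-in-Z {x} x∈U -x∈Z = U≢0 x∈U (trans (sym (neg-involutive x)) (cong -_ (Z≡0 -x∈Z)))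

    zeroCount-decomposition : zeroCount C ≡ length Z
    zeroCount-decomposition = trans (count-on-PUZ (ℤ._≟ 0ℤ))
      (cong₂ _+_ (length-filter-none _ P≢0) (cong₂ _+_ (length-filter-none _ U≢0) (length-filter-all _ Z≡0)))

  ∈-++³⁺ : ∀ {x} {P U Z : List ℤ} → x ∈ P ⊎ x ∈ U ⊎ x ∈ Z → x ∈ P ++ U ++ Z
  ∈-++³⁺ {P = P} (inj₁ x∈P)        = ∈-++⁺ˡ x∈P
  ∈-++³⁺ {P = P} (inj₂ (inj₁ x∈U)) = ∈-++⁺ʳ P (∈-++⁺ˡ x∈U)
  ∈-++³⁺ {P = P} {U} (inj₂ (inj₂ x∈Z)) = ∈-++⁺ʳ P (∈-++⁺ʳ U x∈Z)

  ∈-++³⁻ : ∀ {x} (P U : List ℤ) {Z} → x ∈ P ++ U ++ Z → x ∈ P ⊎ x ∈ U ⊎ x ∈ Z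
  ∈-++³⁻ P U x∈PUZ = Data.Sum.map₂ (∈-++⁻ U) (∈-++⁻ P x∈PUZ)

  colourSet-counts : ∀ {lam mu C} → mu ≤ lam → IsColourSet lam mu C →
    length C ≡ lam × symmetricCount C ≡ lam ∸ mu × zeroCount C ≡ δ lam mu
  colourSet-counts {lam} {mu} {C} mu≤lam (C-unique , P , U , P-unique , U-unique , P∩U , P≢0 , U≢0 , P-neg , U-neg , |U|≡mu , inj₁ (even , |P|≡ , C⇔)) =
    trans length-decomposition (trans (cong₂ _+_ |P|≡ (trans (+-identityʳ _) |U|≡mu)) (m∸n+n≡m mu≤lam)) ,
    trans symmetricCount-decomposition (trans (+-identityʳ _) |P|≡) ,
    trans zeroCount-decomposition (sym even)
    where
    open Decomposition C-unique P-unique U-unique [] (P∩U _) (P≢0 _) (U≢0 _) (P-neg _) (U-neg _) (λ ())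
      (∈-++³⁺ ∘ Data.Sum.map₂ inj₁ ∘ proj₁ (C⇔ _)) (proj₂ (C⇔ _) ∘ [ inj₁ , [ inj₂ , (λ ()) ]′ ]′ ∘ ∈-++³⁻ P U)
  colourSet-counts {lam} {mu} {C} mu≤lam (C-unique , P , U , P-unique , U-unique , P∩U , P≢0 , U≢0 , P-neg , U-neg , |U|≡mu , inj₂ (odd , |P|≡ , C⇔)) =
    trans length-decomposition (begin
      length P + (length U + 1)   ≡⟨ cong (λ u → length P + (u + 1)) |U|≡mu ⟩
      length P + (mu + 1)         ≡⟨ cong (length P +_) (+-comm mu 1) ⟩
      length P + (1 + mu)         ≡⟨ +-assoc (length P) 1 mu ⟨
      length P + 1 + mu           ≡⟨ cong (λ k → k + 1 + mu) |P|≡ ⟩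
      lam ∸ mu ∸ 1 + 1 + mu       ≡⟨ cong (_+ mu) (d∸1+1≡d (lam ∸ mu) odd) ⟩
      lam ∸ mu + mu               ≡⟨ m∸n+n≡m mu≤lam ⟩
      lam                         ∎) ,
    trans symmetricCount-decomposition (trans (cong (_+ 1) |P|≡) (d∸1+1≡d (lam ∸ mu) odd)) ,
    trans zeroCount-decomposition (sym odd)
    where
    open ≡-Reasoning
    zero-only : ∀ {x} → x ∈ [ 0ℤ ] → x ≡ 0ℤ
    zero-only (here x≡0) = x≡0
    open Decomposition C-unique P-unique U-unique (All.[] ∷ []) (P∩U _) (P≢0 _) (U≢0 _) (P-neg _) (U-neg _) zero-only
      (∈-++³⁺ ∘ Data.Sum.map₂ (Data.Sum.map₂ here) ∘ proj₁ (C⇔ _)) (proj₂ (C⇔ _) ∘ Data.Sum.map₂ (Data.Sum.map₂ zero-only) ∘ ∈-++³⁻ P U)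

module ImproperCount (G : SignedGraph) (Y : Subset (m G))
  (conn? : ∀ v w → Dec (Conn G Y v w)) (allPos? : Decidable (AllPosComp G Y)) (negCycle? : Decidable (NegCycle G Y))
  (C : List ℤ) (C-unique : Unique C) where

  open import Data.Integer using (-_; 0ℤ)
  open import Data.Nat using (_+_; _*_; _^_; _∸_; _<_; parity)
  open import Data.Nat.Properties using (+-assoc; m+n∸m≡n)
  open import Data.Nat.Solver using (module +-*-Solver)
  open import Data.Parity.Base as ℙ using ()
  open import Data.List.Membership.DecPropositional ℤ._≟_ using (_∈?_)
  open import Data.Vec.Properties using (lookup∘tabulate; tabulate-cong; tabulate∘lookup)
  open import Relation.Nullary.Decidable using (decidable-stable)
  open Counting
  open Improper G
  open Walks G Y
  open Components G Y conn?
  open Switching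
  open ColourCounts

  balanced? : Decidable (BalancedComp G Y)
  balanced? v = ¬? (negCycle? v)

  Positive BalancedRep Mixed Unbalanced : Pred V 0ℓ
  Positive v    = Rep G Y v × AllPosComp G Y v
  BalancedRep v = Rep G Y v × BalancedComp G Y v
  Mixed v       = BalancedRep v × ¬ AllPosComp G Y v
  Unbalanced v  = Rep G Y v × ¬ BalancedComp G Y v

  positive? : Decidable Positive
  positive? v = rep? v ×-dec allPos? v

  balancedRep? : Decidable BalancedRep
  balancedRep? v = rep? v ×-dec balanced? v

  mixed? : Decidable Mixed
  mixed? v = balancedRep? v ×-dec ¬? (allPos? v)

  unbalanced? : Decidable Unbalanced
  unbalanced? v = rep? v ×-dec ¬? (balanced? v)

  c₀ : ℤ
  c₀ = first C

  -- Non-representatives are pinned to c₀, so a vector Allowed everywhere amounts to one admissible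
  -- colour per component.
  Allowed : V → Pred ℤ 0ℓ
  Allowed v x = (¬ Rep G Y v → x ≡ c₀) × (Mixed v → - x ∈ C) × (Unbalanced v → x ≡ 0ℤ)

  allowed? : ∀ v → Decidable (Allowed v)
  allowed? v x = (¬? (rep? v) →-dec x ℤ.≟ c₀) ×-dec (mixed? v →-dec (- x) ∈? C) ×-dec (unbalanced? v →-dec x ℤ.≟ 0ℤ)

  restrict : Colouring → Colouring
  restrict κ = Vec.tabulate λ v → if does (rep? v) then lookup κ v else c₀

  extend : Colouring → Colouring
  extend ρ = Vec.tabulate λ v → switch (switching v) (lookup ρ (rep v))

  restrict-rep : ∀ κ {v} → Rep G Y v → lookup (restrict κ) v ≡ lookup κ v
  restrict-rep κ {v} v-rep = trans (lookup∘tabulate _ v) (cong (λ b → if b then lookup κ v else c₀) (dec-true (rep? v) v-rep))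

  restrict-nonRep : ∀ κ {v} → ¬ Rep G Y v → lookup (restrict κ) v ≡ c₀
  restrict-nonRep κ {v} ¬v-rep = trans (lookup∘tabulate _ v) (cong (λ b → if b then lookup κ v else c₀) (dec-false (rep? v) ¬v-rep))

  unbalanced⇒negCycle : ∀ {v} → ¬ BalancedComp G Y v → NegCycle G Y v
  unbalanced⇒negCycle {v} = decidable-stable (negCycle? v)

  module _ (κ : Colouring) (κ-∈ : ∀ v → lookup κ v ∈ C) (improper : ImproperOn Y κ) where

    not-allPos⇒negated-colour-∈ : ∀ {v} → ¬ AllPosComp G Y v → - lookup κ v ∈ C
    not-allPos⇒negated-colour-∈ {v} ¬allPos with (- lookup κ v) ∈? C
    ... | yes -κv∈C = -κv∈C
    ... | no  -κv∉C = contradiction allPos ¬allPos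
      where
      allPos : AllPosComp G Y v
      allPos e e∈Y c with σ G e in σe≡
      ... | pos = refl
      ... | neg with negativeEdge⇒negated-colour κ improper e∈Y σe≡ c
      ...   | inj₁ -κv≡κa = contradiction (subst (_∈ C) (sym -κv≡κa) (κ-∈ _)) -κv∉C
      ...   | inj₂ -κv≡κb = contradiction (subst (_∈ C) (sym -κv≡κb) (κ-∈ _)) -κv∉C

    restrict-∈ : ∀ v → lookup (restrict κ) v ∈ C
    restrict-∈ v with rep? v
    ... | yes v-rep = subst (_∈ C) (sym (restrict-rep κ v-rep)) (κ-∈ v)
    ... | no ¬v-rep = subst (_∈ C) (sym (restrict-nonRep κ ¬v-rep)) (first-∈ (κ-∈ v))

    restrict-allowed : Everywhere Allowed (restrict κ)
    restrict-allowed v = restrict-nonRep κ , mixed , unbalanced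
      where
      mixed : Mixed v → - lookup (restrict κ) v ∈ C
      mixed ((v-rep , _) , ¬allPos) = subst (λ x → - x ∈ C) (sym (restrict-rep κ v-rep)) (not-allPos⇒negated-colour-∈ ¬allPos)
      unbalanced : Unbalanced v → lookup (restrict κ) v ≡ 0ℤ
      unbalanced (v-rep , ¬balanced) = trans (restrict-rep κ v-rep) (negCycle⇒colour≡0 κ improper (unbalanced⇒negCycle ¬balanced))

    extend-restrict : extend (restrict κ) ≡ κ
    extend-restrict = trans (tabulate-cong λ v → trans (cong (switch (switching v)) (restrict-rep κ (Rep-rep v))) (sym (colour-via-rep κ improper v)))
                            (tabulate∘lookup κ)

  module _ (ρ : Colouring) (ρ-∈ : ∀ v → lookup ρ v ∈ C) (allowed : Everywhere Allowed ρ) where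

    extend-at : ∀ v → lookup (extend ρ) v ≡ switch (switching v) (lookup ρ (rep v))
    extend-at v = lookup∘tabulate _ v

    unbalanced-rep⇒colour≡0 : ∀ {v} → NegCycle G Y (rep v) → lookup ρ (rep v) ≡ 0ℤ
    unbalanced-rep⇒colour≡0 {v} nc = proj₂ (proj₂ (allowed (rep v))) (Rep-rep v , λ balanced → balanced nc)

    extend-∈ : ∀ v → lookup (extend ρ) v ∈ C
    extend-∈ v = subst (_∈ C) (sym (extend-at v)) (switched-∈ (negCycle? (rep v)) (allPos? (rep v)))
      where
      ρr∈C = ρ-∈ (rep v)
      switched-∈ : Dec (NegCycle G Y (rep v)) → Dec (AllPosComp G Y (rep v)) → switch (switching v) (lookup ρ (rep v)) ∈ C
      switched-∈ (yes nc) _ = switch-∈ (switching v) ρr∈C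
        (subst (λ x → - x ∈ C) (sym (unbalanced-rep⇒colour≡0 nc)) (subst (_∈ C) (unbalanced-rep⇒colour≡0 nc) ρr∈C))
      switched-∈ (no balanced) (yes allPos) = subst (λ p → switch p (lookup ρ (rep v)) ∈ C) (sym (allPos⇒switching≡0ℙ allPos)) ρr∈C
      switched-∈ (no balanced) (no ¬allPos) = switch-∈ (switching v) ρr∈C (proj₁ (proj₂ (allowed (rep v))) ((Rep-rep v , balanced) , ¬allPos))

    extend-improper : ImproperOn Y (extend ρ)
    extend-improper e e∈Y =
      trans (extend-at a) (trans (switched-edge (negCycle? (rep a))) (cong (applySign (σ G e)) (sym (extend-at b))))
      where
      a = proj₁ (ends G e)
      b = proj₂ (ends G e)
      ra≡rb : rep a ≡ rep b
      ra≡rb = rep-cong (edge e∈Y)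
      switched-edge : Dec (NegCycle G Y (rep a)) →
        switch (switching a) (lookup ρ (rep a)) ≡ applySign (σ G e) (switch (switching b) (lookup ρ (rep b)))
      switched-edge (yes nc) = begin
        switch (switching a) (lookup ρ (rep a))                       ≡⟨ cong (switch (switching a)) (unbalanced-rep⇒colour≡0 nc) ⟩
        switch (switching a) 0ℤ                                       ≡⟨ switch-0ℤ (switching a) ⟩
        0ℤ                                                            ≡⟨ trans (applySign≗switch (σ G e) 0ℤ) (switch-0ℤ (signParity (σ G e))) ⟨
        applySign (σ G e) 0ℤ                                          ≡⟨ cong (applySign (σ G e)) (switch-0ℤ (switching b)) ⟨
        applySign (σ G e) (switch (switching b) 0ℤ)                   ≡⟨ cong (applySign (σ G e) ∘ switch (switching b)) (unbalanced-rep⇒colour≡0 (subst (NegCycle G Y) ra≡rb nc)) ⟨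
        applySign (σ G e) (switch (switching b) (lookup ρ (rep b)))   ∎
        where open ≡-Reasoning
      switched-edge (no balanced) = begin
        switch (switching a) (lookup ρ (rep a))                       ≡⟨ cong (λ p → switch p (lookup ρ (rep a))) (balanced⇒switching-edge balanced e∈Y (inj₁ refl)) ⟩
        switch (switching b ℙ.+ signParity (σ G e)) (lookup ρ (rep a)) ≡⟨ switch-+ (switching b) _ _ ⟩
        switch (signParity (σ G e)) (switch (switching b) (lookup ρ (rep a))) ≡⟨ applySign≗switch (σ G e) _ ⟨
        applySign (σ G e) (switch (switching b) (lookup ρ (rep a)))   ≡⟨ cong (λ r → applySign (σ G e) (switch (switching b) (lookup ρ r))) ra≡rb ⟩
        applySign (σ G e) (switch (switching b) (lookup ρ (rep b)))   ∎
        where open ≡-Reasoning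

    restrict-extend : restrict (extend ρ) ≡ ρ
    restrict-extend = trans (sym (tabulate∘lookup _)) (trans (tabulate-cong λ v → at (rep? v)) (tabulate∘lookup ρ))
      where
      rep-colour : ∀ {v} → Rep G Y v → Dec (NegCycle G Y v) → switch (switching v) (lookup ρ v) ≡ lookup ρ v
      rep-colour {v} v-rep (yes nc) = trans (cong (switch (switching v)) ρv≡0) (trans (switch-0ℤ (switching v)) (sym ρv≡0))
        where
        ρv≡0 : lookup ρ v ≡ 0ℤ
        ρv≡0 = proj₂ (proj₂ (allowed v)) (v-rep , λ balanced → balanced nc)
      rep-colour {v} v-rep (no balanced) = cong (λ p → switch p (lookup ρ v)) (balanced⇒switching≡0ℙ v-rep balanced)
      at : ∀ {v} → Dec (Rep G Y v) → lookup (restrict (extend ρ)) v ≡ lookup ρ v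
      at {v} (no ¬v-rep) = trans (restrict-nonRep (extend ρ) ¬v-rep) (sym (proj₁ (allowed v) ¬v-rep))
      at {v} (yes v-rep) = trans (restrict-rep (extend ρ) v-rep) (trans (extend-at v)
        (trans (cong (λ r → switch (switching v) (lookup ρ r)) (Rep⇒rep≡ v-rep)) (rep-colour v-rep (negCycle? v))))

  improper-count≡∏ : length (filter (improperOn? Y) (allMaps (n G) C)) ≡ ∏ (λ v → length (filter (allowed? v) C))
  improper-count≡∏ = trans
    (length-filter-≡-by-inverses (improperOn? Y) (everywhere? allowed?) (allMaps⁺ (n G) C-unique) (allMaps⁺ (n G) C-unique)
      restrict extend to from)
    (length-filter-allMaps allowed? C)
    where
    to : ∀ {κ} → κ ∈ allMaps (n G) C → ImproperOn Y κ →
      restrict κ ∈ allMaps (n G) C × Everywhere Allowed (restrict κ) × extend (restrict κ) ≡ κ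
    to {κ} κ∈ improper = ∈-allMaps⁺ _ (restrict-∈ κ κ-∈ improper) , restrict-allowed κ κ-∈ improper , extend-restrict κ κ-∈ improper
      where κ-∈ = ∈-allMaps⁻ κ∈
    from : ∀ {ρ} → ρ ∈ allMaps (n G) C → Everywhere Allowed ρ →
      extend ρ ∈ allMaps (n G) C × ImproperOn Y (extend ρ) × restrict (extend ρ) ≡ ρ
    from {ρ} ρ∈ allowed = ∈-allMaps⁺ _ (extend-∈ ρ ρ-∈ allowed) , extend-improper ρ ρ-∈ allowed , restrict-extend ρ ρ-∈ allowed
      where ρ-∈ = ∈-allMaps⁻ ρ∈

  factor : V → ℕ
  factor v = firstCount C ^ 𝟙 (¬? (rep? v))
           * (length C ^ 𝟙 (positive? v) * (symmetricCount C ^ 𝟙 (mixed? v) * zeroCount C ^ 𝟙 (unbalanced? v)))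

  factor-as : ∀ {v} i j k l → 𝟙 (¬? (rep? v)) ≡ i → 𝟙 (positive? v) ≡ j → 𝟙 (mixed? v) ≡ k → 𝟙 (unbalanced? v) ≡ l →
    factor v ≡ firstCount C ^ i * (length C ^ j * (symmetricCount C ^ k * zeroCount C ^ l))
  factor-as i j k l refl refl refl refl = refl

  allowed-count-as : ∀ {v} {Q : Pred ℤ 0ℓ} (Q? : Decidable Q) → (∀ {x} → Allowed v x ⇔ Q x) →
    length (filter (allowed? v) C) ≡ length (filter Q? C)
  allowed-count-as {v} Q? Allowed⇔Q = cong length (filter-≐ (allowed? v) Q? (Equivalence.to Allowed⇔Q , Equivalence.from Allowed⇔Q) C)

  module _ {v : V} where

    open +-*-Solver
    private
      F = firstCount C
      L = length C
      S = symmetricCount C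
      Z = zeroCount C

    allowed-count-nonRep : ¬ Rep G Y v → length (filter (allowed? v) C) ≡ factor v
    allowed-count-nonRep ¬rep = begin
      length (filter (allowed? v) C)    ≡⟨ allowed-count-as (ℤ._≟ c₀) (mk⇔ (λ (to-c₀ , _) → to-c₀ ¬rep)
                                            λ x≡c₀ → (λ _ → x≡c₀) , (λ m → contradiction (proj₁ (proj₁ m)) ¬rep) , λ u → contradiction (proj₁ u) ¬rep) ⟩
      F                                 ≡⟨ solve 4 (λ f l s z → f := f :^ 1 :* (l :^ 0 :* (s :^ 0 :* z :^ 0))) refl F L S Z ⟩
      F ^ 1 * (L ^ 0 * (S ^ 0 * Z ^ 0)) ≡⟨ factor-as 1 0 0 0 (𝟙-yes (¬? (rep? v)) ¬rep) (𝟙-no (positive? v) (¬rep ∘ proj₁))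
                                            (𝟙-no (mixed? v) (¬rep ∘ proj₁ ∘ proj₁)) (𝟙-no (unbalanced? v) (¬rep ∘ proj₁)) ⟨
      factor v                          ∎
      where open ≡-Reasoning

    allowed-count-positive : Rep G Y v → AllPosComp G Y v → length (filter (allowed? v) C) ≡ factor v
    allowed-count-positive rep allPos = begin
      length (filter (allowed? v) C)    ≡⟨ allowed-count-as U? (mk⇔ (λ _ → tt)
                                            λ _ → (λ ¬rep → contradiction rep ¬rep) , (λ m → contradiction allPos (proj₂ m))
                                                , λ u → contradiction (allPos⇒balanced allPos) (proj₂ u)) ⟩
      length (filter U? C)              ≡⟨ cong length (filter-all U? (All.universal (λ _ → tt) C)) ⟩
      L                                 ≡⟨ solve 4 (λ f l s z → l := f :^ 0 :* (l :^ 1 :* (s :^ 0 :* z :^ 0))) refl F L S Z ⟩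
      F ^ 0 * (L ^ 1 * (S ^ 0 * Z ^ 0)) ≡⟨ factor-as 0 1 0 0 (𝟙-no (¬? (rep? v)) (λ ¬rep → ¬rep rep)) (𝟙-yes (positive? v) (rep , allPos))
                                            (𝟙-no (mixed? v) (λ m → proj₂ m allPos)) (𝟙-no (unbalanced? v) (λ u → proj₂ u (allPos⇒balanced allPos))) ⟨
      factor v                          ∎
      where open ≡-Reasoning

    allowed-count-mixed : Mixed v → length (filter (allowed? v) C) ≡ factor v
    allowed-count-mixed mixed@((rep , balanced) , ¬allPos) = begin
      length (filter (allowed? v) C)    ≡⟨ allowed-count-as (λ x → ℤ.- x ∈? C) (mk⇔ (λ (_ , to-neg , _) → to-neg mixed)
                                            λ -x∈C → (λ ¬rep → contradiction rep ¬rep) , (λ _ → -x∈C) , λ u → contradiction balanced (proj₂ u)) ⟩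
      S                                 ≡⟨ solve 4 (λ f l s z → s := f :^ 0 :* (l :^ 0 :* (s :^ 1 :* z :^ 0))) refl F L S Z ⟩
      F ^ 0 * (L ^ 0 * (S ^ 1 * Z ^ 0)) ≡⟨ factor-as 0 0 1 0 (𝟙-no (¬? (rep? v)) (λ ¬rep → ¬rep rep)) (𝟙-no (positive? v) (¬allPos ∘ proj₂))
                                            (𝟙-yes (mixed? v) mixed) (𝟙-no (unbalanced? v) (λ u → proj₂ u balanced)) ⟨
      factor v                          ∎
      where open ≡-Reasoning

    allowed-count-unbalanced : Rep G Y v → NegCycle G Y v → length (filter (allowed? v) C) ≡ factor v
    allowed-count-unbalanced rep nc = begin
      length (filter (allowed? v) C)    ≡⟨ allowed-count-as (ℤ._≟ 0ℤ) (mk⇔ (λ (_ , _ , to-zero) → to-zero unbalanced)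
                                            λ x≡0 → (λ ¬rep → contradiction rep ¬rep) , (λ m → contradiction nc (proj₂ (proj₁ m))) , λ _ → x≡0) ⟩
      Z                                 ≡⟨ solve 4 (λ f l s z → z := f :^ 0 :* (l :^ 0 :* (s :^ 0 :* z :^ 1))) refl F L S Z ⟩
      F ^ 0 * (L ^ 0 * (S ^ 0 * Z ^ 1)) ≡⟨ factor-as 0 0 0 1 (𝟙-no (¬? (rep? v)) (λ ¬rep → ¬rep rep)) (𝟙-no (positive? v) (λ p → allPos⇒balanced (proj₂ p) nc))
                                            (𝟙-no (mixed? v) (λ m → proj₂ (proj₁ m) nc)) (𝟙-yes (unbalanced? v) unbalanced) ⟨
      factor v                          ∎
      where
      open ≡-Reasoning
      unbalanced : Unbalanced v
      unbalanced = rep , λ balanced → balanced nc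

  allowed-count : ∀ v → length (filter (allowed? v) C) ≡ factor v
  allowed-count v = by-cases (rep? v) (allPos? v) (negCycle? v)
    where
    by-cases : Dec (Rep G Y v) → Dec (AllPosComp G Y v) → Dec (NegCycle G Y v) → length (filter (allowed? v) C) ≡ factor v
    by-cases (no ¬rep) _            _             = allowed-count-nonRep ¬rep
    by-cases (yes rep) (yes allPos) _             = allowed-count-positive rep allPos
    by-cases (yes rep) (no ¬allPos) (no balanced) = allowed-count-mixed ((rep , balanced) , ¬allPos)
    by-cases (yes rep) (no _)       (yes nc)      = allowed-count-unbalanced rep nc

  ∏-factor : ∏ factor ≡ firstCount C ^ count (¬? ∘ rep?)
    * (length C ^ count positive? * (symmetricCount C ^ count mixed? * zeroCount C ^ count unbalanced?))
  ∏-factor = begin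
    ∏ factor
      ≡⟨ ∏-distrib-* (λ v → firstCount C ^ 𝟙 (¬? (rep? v))) _ ⟩
    ∏ (λ v → firstCount C ^ 𝟙 (¬? (rep? v))) * ∏ (λ v → length C ^ 𝟙 (positive? v) * (symmetricCount C ^ 𝟙 (mixed? v) * zeroCount C ^ 𝟙 (unbalanced? v)))
      ≡⟨ cong₂ _*_ (∏-^-count (¬? ∘ rep?) (firstCount C)) (trans (∏-distrib-* (λ v → length C ^ 𝟙 (positive? v)) _)
           (cong₂ _*_ (∏-^-count positive? (length C)) (trans (∏-distrib-* (λ v → symmetricCount C ^ 𝟙 (mixed? v)) _)
             (cong₂ _*_ (∏-^-count mixed? (symmetricCount C)) (∏-^-count unbalanced? (zeroCount C)))))) ⟩
    firstCount C ^ count (¬? ∘ rep?) * (length C ^ count positive? * (symmetricCount C ^ count mixed? * zeroCount C ^ count unbalanced?)) ∎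
    where open ≡-Reasoning

  count-balancedRep : count balancedRep? ≡ count positive? + count mixed?
  count-balancedRep = trans (length-filter-partition balancedRep? allPos? (allFin (n G)))
    (cong (_+ count mixed?) (count-cong _ positive?
      (mk⇔ (λ ((rep , _) , allPos) → rep , allPos) λ (rep , allPos) → (rep , allPos⇒balanced allPos) , allPos)))

  count-rep : count rep? ≡ count positive? + (count mixed? + count unbalanced?)
  count-rep = trans (length-filter-partition rep? balanced? (allFin (n G)))
    (trans (cong (_+ count unbalanced?) count-balancedRep) (+-assoc (count positive?) _ _))

  improper-count : ∀ {c b p} → IsC G Y c → IsB G Y b → IsP G Y p →
    length (filter (improperOn? Y) (allMaps (n G) C)) ≡ length C ^ p * (symmetricCount C ^ (b ∸ p) * zeroCount C ^ (c ∸ b))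
  improper-count {c} {b} {p} hc hb hp = begin
    length (filter (improperOn? Y) (allMaps (n G) C))
      ≡⟨ trans improper-count≡∏ (trans (∏-cong allowed-count) ∏-factor) ⟩
    firstCount C ^ count (¬? ∘ rep?) * (length C ^ count positive? * (symmetricCount C ^ count mixed? * zeroCount C ^ count unbalanced?))
      ≡⟨ firstCount-factor C C-unique (count (¬? ∘ rep?)) (count positive?) (count mixed?) (count unbalanced?) nonRep⇒rep ⟩
    length C ^ count positive? * (symmetricCount C ^ count mixed? * zeroCount C ^ count unbalanced?)
      ≡⟨ cong₂ (λ i j → length C ^ p′ * (symmetricCount C ^ i * zeroCount C ^ j)) b∸p c∸b ⟨
    length C ^ p′ * (symmetricCount C ^ (b ∸ p) * zeroCount C ^ (c ∸ b))
      ≡⟨ cong (λ i → length C ^ i * _) p′≡p ⟩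
    length C ^ p * (symmetricCount C ^ (b ∸ p) * zeroCount C ^ (c ∸ b)) ∎
    where
    open ≡-Reasoning
    p′ = count positive?
    p′≡p : p′ ≡ p
    p′≡p = hasCount⇒count positive? hp
    b≡ : b ≡ count positive? + count mixed?
    b≡ = trans (sym (hasCount⇒count balancedRep? hb)) count-balancedRep
    c≡ : c ≡ count balancedRep? + count unbalanced?
    c≡ = trans (sym (hasCount⇒count rep? hc)) (length-filter-partition rep? balanced? (allFin (n G)))
    b∸p : b ∸ p ≡ count mixed?
    b∸p = trans (cong₂ _∸_ b≡ (sym p′≡p)) (m+n∸m≡n (count positive?) _)
    c∸b : c ∸ b ≡ count unbalanced?
    c∸b = trans (cong₂ _∸_ c≡ (sym (hasCount⇒count balancedRep? hb))) (m+n∸m≡n (count balancedRep?) _)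
    nonRep⇒rep : 0 < count (¬? ∘ rep?) → 0 < count positive? + (count mixed? + count unbalanced?)
    nonRep⇒rep nonRep>0 = subst (0 <_) count-rep (count-pos rep? (Rep-rep (proj₁ (count>0⇒∃ (¬? ∘ rep?) nonRep>0))))


open import Data.Nat using (_≤_)
open import Data.Integer using (+_)
open import Data.Fin.Subset.Properties using (∣p∣≤n)
open Sums using (sumℤ-by-key; subsets; pos-^)
open Improper using (numProper-inclusion–exclusion; improperOn?)
open ColourCounts using (symmetricCount; zeroCount)

¬¬-∀-Fin : ∀ {k} {P : Fin k → Set} → (∀ i → ¬ ¬ P i) → ¬ ¬ (∀ i → P i)
¬¬-∀-Fin {zero}  _   = return λ ()
  where open RawMonad ¬¬-Monad
¬¬-∀-Fin {suc k} ¬¬P = do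
  p₀ ← ¬¬P Fin.zero
  p₊ ← ¬¬-∀-Fin (¬¬P ∘ Fin.suc)
  return λ { Fin.zero → p₀ ; (Fin.suc i) → p₊ i }
  where open RawMonad ¬¬-Monad

-- Connectivity, all-positivity and balance are not decided constructively here, but the goal
-- is an equation of naturals, so excluded middle may be used under ¬¬.
improper-count : ∀ G Y (C : List ℤ) → Unique C → ∀ {c b p} → IsC G Y c → IsB G Y b → IsP G Y p →
  length (filter (improperOn? G Y) (allMaps (n G) C))
    ≡ length C ℕ.^ p ℕ.* (symmetricCount C ℕ.^ (b ℕ.∸ p) ℕ.* zeroCount C ℕ.^ (c ℕ.∸ b))
improper-count G Y C C-unique hc hb hp = decidable-stable (_ ℕ.≟ _) do
  conn?     ← ¬¬-∀-Fin λ v → ¬¬-∀-Fin λ w → ¬¬-excluded-middle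
  allPos?   ← ¬¬-∀-Fin λ v → ¬¬-excluded-middle
  negCycle? ← ¬¬-∀-Fin λ v → ¬¬-excluded-middle
  return (ImproperCount.improper-count G Y conn? allPos? negCycle? C C-unique hc hb hp)
  where open RawMonad ¬¬-Monad

improper-count-colourSet : ∀ G Y {lam mu C} → mu ≤ lam → IsColourSet lam mu C → ∀ {c b p} → IsC G Y c → IsB G Y b → IsP G Y p →
  + length (filter (improperOn? G Y) (allMaps (n G) C))
    ≡ (+ lam) ℤ.^ p ℤ.* ((+ (lam ℕ.∸ mu)) ℤ.^ (b ℕ.∸ p) ℤ.* (+ δ lam mu) ℤ.^ (c ℕ.∸ b))
improper-count-colourSet G Y {lam} {mu} {C} mu≤lam isC {c} {b} {p} hc hb hp = begin
  + length (filter (improperOn? G Y) (allMaps (n G) C))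
    ≡⟨ cong +_ (improper-count G Y C (proj₁ isC) hc hb hp) ⟩
  + (length C ℕ.^ p ℕ.* (symmetricCount C ℕ.^ (b ℕ.∸ p) ℕ.* zeroCount C ℕ.^ (c ℕ.∸ b)))
    ≡⟨ cong +_ (cong₂ (λ k l → k ℕ.^ p ℕ.* l) |C|≡lam (cong₂ (λ k l → k ℕ.^ (b ℕ.∸ p) ℕ.* l ℕ.^ (c ℕ.∸ b)) symmetric≡ zero≡)) ⟩
  + (lam ℕ.^ p ℕ.* ((lam ℕ.∸ mu) ℕ.^ (b ℕ.∸ p) ℕ.* δ lam mu ℕ.^ (c ℕ.∸ b)))
    ≡⟨ trans (ℤₚ.pos-* (lam ℕ.^ p) _) (cong₂ ℤ._*_ (pos-^ lam p)
         (trans (ℤₚ.pos-* ((lam ℕ.∸ mu) ℕ.^ (b ℕ.∸ p)) _) (cong₂ ℤ._*_ (pos-^ (lam ℕ.∸ mu) (b ℕ.∸ p)) (pos-^ (δ lam mu) (c ℕ.∸ b))))) ⟩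
  (+ lam) ℤ.^ p ℤ.* ((+ (lam ℕ.∸ mu)) ℤ.^ (b ℕ.∸ p) ℤ.* (+ δ lam mu) ℤ.^ (c ℕ.∸ b)) ∎
  where
  open ≡-Reasoning
  counts = ColourSets.colourSet-counts mu≤lam isC
  |C|≡lam = proj₁ counts
  symmetric≡ = proj₁ (proj₂ counts)
  zero≡ = proj₂ (proj₂ counts)

theorem4p4 : (G : SignedGraph) (lam mu : ℕ) → mu ≤ lam →
    (C : List ℤ) → IsColourSet lam mu C →
    (c b p : Subset (m G) → ℕ) →
    (∀ Y → IsC G Y (c Y)) → (∀ Y → IsB G Y (b Y)) → (∀ Y → IsP G Y (p Y)) →
    + numProper G C ≡ rhs G lam mu c b p
theorem4p4 G lam mu mu≤lam C isC c b p hc hb hp = begin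
  + numProper G C
    ≡⟨ numProper-inclusion–exclusion G C ⟩
  sumℤ (map (λ Y → ℤ.-1ℤ ℤ.^ ∣ Y ∣ ℤ.* + length (filter (improperOn? G Y) (allMaps (n G) C))) (subsets (m G)))
    ≡⟨ cong sumℤ (map-cong (λ Y → cong (ℤ.-1ℤ ℤ.^ ∣ Y ∣ ℤ.*_) (improper-count-colourSet G Y mu≤lam isC (hc Y) (hb Y) (hp Y))) (subsets (m G))) ⟩
  sumℤ (map (λ Y → ℤ.-1ℤ ℤ.^ ∣ Y ∣ ℤ.* term Y) (subsets (m G)))
    ≡⟨ sumℤ-by-key ∣_∣ (ℤ.-1ℤ ℤ.^_) term (suc (m G)) (subsets (m G)) (All.universal (λ Y → s≤s (∣p∣≤n Y)) _) ⟨
  rhs G lam mu c b p ∎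
  where
  open ≡-Reasoning
  term : Subset (m G) → ℤ
  term Y = (+ lam) ℤ.^ p Y ℤ.* ((+ (lam ℕ.∸ mu)) ℤ.^ (b Y ℕ.∸ p Y) ℤ.* (+ δ lam mu) ℤ.^ (c Y ℕ.∸ b Y))
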